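{- Let $\mathcal{M}$ be a realized matroid over $\mathbb{Z}$ on the ground set $[n]$ with $\mathcal{M}(\emptyset)=\mathbb{Z}^{d}$ free. Then $\operatorname{Gr}\mathcal{M}$, with the partial order generated by the covering relation, is a simplicial poset.
   Context: A matroid over $\mathbb{Z}$ on $[n]=\{1,\dots,n\}$ assigns to each $A\subseteq[n]$ a finitely generated abelian group $\mathcal{M}(A)$ (up to isomorphism). It is realized if a list $z_1,\dots,z_n\in\mathcal{M}(\emptyset)$ is fixed with $\mathcal{M}(A)=\mathcal{M}(\emptyset)/(z_i : i\in A)$ for all $A$. Write $\mathcal{M}(A)\cong\mathbb{Z}^{d(A)}\times G_A$ with $G_A$ finite (the torsion subgroup), and $C_A=\operatorname{Hom}(G_A,\mathbb{C}^*)$ its dual group. For $A\subseteq[n]$ and $b\notin A$, the canonical projection $\pi_{(A,b)}:\mathcal{M}(A)\to\mathcal{M}(A\cup\{b\})$ is the quotient map by the image of $z_b$; it sends $G_A$ into $G_{A\cup\{b\}}$, and the dual map $\pi^{(A,b)}:C_{A\cup\{b\}}\to C_A$ is $h\mapsto h\circ\pi_{(A,b)}|_{G_A}$. The set of torsions $\operatorname{Gr}\mathcal{M}$ is the set of pairs $(A,l)$ with $A\subseteq[n]$, $d(\emptyset)-d(A)=\#A$ and $l\in C_A$. For $(A\cup\{b\},h),(A,l)\in\operatorname{Gr}\mathcal{M}$ with $b\notin A$, we say $(A\cup\{b\},h)$ covers $(A,l)$ if $\pi^{(A,b)}(h)=l$; $\operatorname{Gr}\mathcal{M}$ is partially ordered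 by the reflexive–transitive closure of this covering relation. A finite poset with a unique minimal element $\hat 0$ is simplicial if for every element $\sigma$ the interval $[\hat0,\sigma]=\{x:\hat0\le x\le\sigma\}$ is isomorphic to a Boolean lattice. -}

module Defs where

open import Data.Nat as ℕ using (ℕ; zero; suc)
open import Data.Integer as ℤ using (ℤ; +_)
open import Data.Rational as ℚ using (ℚ)
open import Data.Fin using (Fin) renaming (zero to fzero; suc to fsuc)
open import Data.Fin.Subset using (Subset; _∈_; _∉_; _∪_; ⁅_⁆; _⊆_)
open import Data.Vec using (Vec; replicate; zipWith; map)
open import Data.List using (List)
open import Data.List.Membership.Propositional using () renaming (_∈_ to _∈ₗ_)
open import Data.Product using (proj₁; Σ; ∃; ∃-syntax; _×_; _,_)
open import Data.Sum using (_⊎_)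
open import Relation.Binary.PropositionalEquality using (_≡_)
open import Relation.Binary.Construct.Closure.ReflexiveTransitive using (Star)
open import Function.Bundles using (_⇔_)

_+ᵥ_ : ∀ {d} → Vec ℤ d → Vec ℤ d → Vec ℤ d
_+ᵥ_ = zipWith ℤ._+_

_-ᵥ_ : ∀ {d} → Vec ℤ d → Vec ℤ d → Vec ℤ d
_-ᵥ_ = zipWith ℤ._-_

_·ᵥ_ : ∀ {d} → ℤ → Vec ℤ d → Vec ℤ d
k ·ᵥ v = map (k ℤ.*_) v

0ᵥ : ∀ {d} → Vec ℤ d
0ᵥ = replicate _ (+ 0)

lincomb : ∀ {n d} → (Fin n → Vec ℤ d) → (Fin n → ℤ) → Vec ℤ d
lincomb {zero}  z c = 0ᵥ
lincomb {suc n} z c = (c fzero ·ᵥ z fzero) +ᵥ lincomb (λ i → z (fsuc i)) (λ i → c (fsuc i))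

-- ℚ/ℤ  (the torsion part of ℂ^*, receiving all characters of finite groups)

_≈ℚ/ℤ_ : ℚ → ℚ → Set
q ≈ℚ/ℤ r = ∃[ m ] (q ℚ.- r ≡ m ℚ./ 1)

-- The realized matroid over ℤ given by z₁,…,zₙ ∈ ℤ^d = M(∅)

module Realized {n d : ℕ} (z : Fin n → Vec ℤ d) where

  SupportedOn : Subset n → (Fin n → ℤ) → Set
  SupportedOn A c = ∀ i → i ∉ A → c i ≡ + 0

  InSpan : Subset n → Vec ℤ d → Set
  InSpan A v = ∃[ c ] (SupportedOn A c × lincomb z c ≡ v)

  -- v represents an element of the torsion subgroup G_A of M(A) = ℤ^d/(z_i : i∈A)
  IsTors : Subset n → Vec ℤ d → Set
  IsTors A v = ∃[ k ] (ℕ.NonZero k × InSpan A ((+ k) ·ᵥ v))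

  -- d(∅) - d(A) = #A, i.e. rank (z_i : i ∈ A) = #A, i.e. (z_i)_{i∈A} is
  -- linearly independent
  RankCond : Subset n → Set
  RankCond A = ∀ c → SupportedOn A c → lincomb z c ≡ 0ᵥ → ∀ i → c i ≡ + 0

  -- characters of G_A with values in ℚ/ℤ, given on representatives
  record Char (A : Subset n) : Set where
    field
      χ        : Vec ℤ d → ℚ
      wellDef  : ∀ v w → IsTors A v → IsTors A w → InSpan A (v -ᵥ w) → χ v ≈ℚ/ℤ χ w
      additive : ∀ v w → IsTors A v → IsTors A w → χ (v +ᵥ w) ≈ℚ/ℤ (χ v ℚ.+ χ w)
  open Char public

  record Gr : Set where
    constructor ⟨_,_,_⟩
    field
      set  : Subset n
      rank : RankCond set
      chr  : Char set
  open Gr public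

  _≈_ : Gr → Gr → Set
  x ≈ y = (set x ≡ set y) × (∀ v → IsTors (set x) v → χ (chr x) v ≈ℚ/ℤ χ (chr y) v)

  -- (A ∪ {b}, h) covers (A, l):  π^{(A,b)}(h) = h ∘ π_{(A,b)}|_{G_A} = l
  Covers : Gr → Gr → Set
  Covers σ τ = ∃[ b ] (b ∉ set τ × set σ ≡ set τ ∪ ⁅ b ⁆ ×
                 (∀ v → IsTors (set τ) v → χ (chr σ) v ≈ℚ/ℤ χ (chr τ) v))

  _≤_ : Gr → Gr → Set
  _≤_ = Star (λ x y → x ≈ y ⊎ Covers y x)

  Interval : Gr → Gr → Set
  Interval lo hi = Σ Gr (λ x → lo ≤ x × x ≤ hi)

record IsSimplicialPoset (P : Set) (_≈_ : P → P → Set) (_≤_ : P → P → Set) : Set₁ where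
  Minimal : P → Set
  Minimal x = ∀ y → y ≤ x → y ≈ x
  field
    finite   : ∃[ xs ] (∀ x → ∃[ y ] (y ∈ₗ xs × x ≈ y))
    -- partial order (reflexivity/transitivity hold by construction)
    antisym  : ∀ x y → x ≤ y → y ≤ x → x ≈ y
    0̂        : P
    0̂-min    : Minimal 0̂
    0̂-unique : ∀ x → Minimal x → x ≈ 0̂
    boolean  : ∀ σ → ∃[ k ] Σ (Σ P (λ x → 0̂ ≤ x × x ≤ σ) → Subset k) λ f →
                 Σ (Subset k → Σ P (λ x → 0̂ ≤ x × x ≤ σ)) λ g →
                   (∀ S → f (g S) ≡ S)
                 × (∀ x → proj₁ (g (f x)) ≈ proj₁ x)
                 × (∀ x y → (proj₁ x ≤ proj₁ y) ⇔ (f x ⊆ f y))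

-- The order on Gr M has a direct description: (A , l) ≤ (B , h) iff A ⊆ B and h restricts to l
-- on G_A, since a chain of covers adds the elements of B ∖ A one at a time without changing the
-- character. Antisymmetry follows, (∅ , 0) is the least element, and A ↦ (A , h restricted to G_A)
-- identifies the subsets of B with the interval [0̂ , (B , h)].
--
-- For an independent A, integral elimination gives functionals
-- φ_i with φ_i(z_j) = N δ_ij on A. Then N v = Σ φ_i(v) z_i for every torsion v, so N kills G_A, the
-- class of v modulo the span is determined by the residues (φ_i(v) mod N)_i, and a character is a
-- table of values in (1/N)ℤ/ℤ on the finitely many residue vectors. Whether a table is additive
-- on representatives is decidable, so the valid tables, hence the characters, can be listed.

module Submission where

open import Defs

open import Data.Bool using (true; false)
open import Data.Empty using (⊥-elim)
open import Data.Fin as F using (Fin) renaming (zero to fzero; suc to fsuc)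
import Data.Fin.Properties as FP
open import Data.Fin.Subset as SS using (Subset; _∈_; _∉_; _∪_; ⁅_⁆; _⊆_; _⊃_)
open import Data.Fin.Subset.Induction using (⊃-wellFounded; Acc; acc)
import Data.Fin.Subset.Properties as SSP
open import Data.Integer as ℤ using (ℤ; +_; -[1+_]; _+_; _*_; _-_; -_)
open import Data.Integer.DivMod using (_%ℕ_; _/ℕ_; n%ℕd<d; a≡a%ℕn+[a/ℕn]*n)
open import Data.Integer.GCD using (gcd; gcd-zeroʳ)
import Data.Integer.Properties as ℤP
open import Data.Integer.Tactic.RingSolver using (solve-∀)
open import Data.List as L using (List)
open import Data.List.Membership.Propositional using () renaming (_∈_ to _∈ₗ_)
import Data.List.Membership.Propositional.Properties as ∈ₗ
import Data.List.Relation.Unary.All as All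
import Data.List.Relation.Unary.Any as Any
import Data.List.Relation.Unary.Any.Properties as Any
open import Data.Nat as ℕ using (ℕ; zero; suc)
import Data.Nat.DivMod as ℕD
import Data.Nat.Properties as ℕP
open import Data.Product using (proj₁; proj₂; Σ; ∃-syntax; _×_; _,_)
open import Data.Rational as ℚ using (ℚ; 0ℚ; 1ℚ; toℚᵘ)
import Data.Rational.Properties as ℚP
open import Data.Rational.Unnormalised as ℚᵘ using (mkℚᵘ; *≡*)
import Data.Rational.Unnormalised.Properties as ℚᵘP
open import Data.Sum using (_⊎_; inj₁; inj₂; [_,_]′)
open import Data.Vec as V using (Vec; []; _∷_; lookup; here; there)
import Data.Vec.Properties as VP
open import Function using (_∘_; _⇔_; mk⇔)
open import Relation.Binary.Bundles using (Setoid)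
open import Relation.Binary.Construct.Closure.ReflexiveTransitive using (ε; _◅_; _◅◅_)
open import Relation.Binary.PropositionalEquality
import Relation.Binary.Reasoning.Setoid
open import Relation.Nullary using (¬_; Dec; yes; no)
open import Relation.Nullary.Decidable using (_×-dec_; _→-dec_; ¬?; map′; dec⇒maybe)
import Tactic.RingSolver as RS
import Tactic.RingSolver.Core.AlmostCommutativeRing as ACR

open import Algebra.Properties.Semiring.Sum ℤP.+-*-semiring
  using (sum; sum-cong-≗; sum-remove; sum-replicate-zero; ∑-distrib-+; *-distribˡ-sum)

lookup-ext : ∀ {A : Set} {m} {u v : Vec A m} → (∀ p → lookup u p ≡ lookup v p) → u ≡ v
lookup-ext {u = u} {v} eq = begin
  u                     ≡⟨ VP.tabulate∘lookup u ⟨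
  V.tabulate (lookup u) ≡⟨ VP.tabulate-cong eq ⟩
  V.tabulate (lookup v) ≡⟨ VP.tabulate∘lookup v ⟩
  v                     ∎
  where open ≡-Reasoning

lookup-+ᵥ : ∀ {d} (u v : Vec ℤ d) p → lookup (u +ᵥ v) p ≡ lookup u p + lookup v p
lookup-+ᵥ u v p = VP.lookup-zipWith _ p u v

lookup--ᵥ : ∀ {d} (u v : Vec ℤ d) p → lookup (u -ᵥ v) p ≡ lookup u p - lookup v p
lookup--ᵥ u v p = VP.lookup-zipWith _ p u v

lookup-·ᵥ : ∀ {d} k (v : Vec ℤ d) p → lookup (k ·ᵥ v) p ≡ k * lookup v p
lookup-·ᵥ k v p = VP.lookup-map p _ v

lookup-0ᵥ : ∀ {d} p → lookup (0ᵥ {d}) p ≡ + 0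
lookup-0ᵥ p = VP.lookup-replicate p _

·ᵥ-zeroˡ : ∀ {d} (v : Vec ℤ d) → (+ 0) ·ᵥ v ≡ 0ᵥ
·ᵥ-zeroˡ v = VP.map-const v (+ 0)

·ᵥ-zeroʳ : ∀ {d} k → k ·ᵥ 0ᵥ {d} ≡ 0ᵥ
·ᵥ-zeroʳ k = trans (VP.map-replicate (_*_ k) (+ 0) _) (cong (V.replicate _) (ℤP.*-zeroʳ k))

·ᵥ-identityˡ : ∀ {d} (v : Vec ℤ d) → (+ 1) ·ᵥ v ≡ v
·ᵥ-identityˡ v = trans (VP.map-cong ℤP.*-identityˡ v) (VP.map-id v)

·ᵥ-suc : ∀ {d} k (v : Vec ℤ d) → (+ suc k) ·ᵥ v ≡ v +ᵥ ((+ k) ·ᵥ v)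
·ᵥ-suc k v = lookup-ext λ p → begin
  lookup ((+ suc k) ·ᵥ v) p          ≡⟨ lookup-·ᵥ (+ suc k) v p ⟩
  (+ 1 + + k) * lookup v p           ≡⟨ unfold (+ k) (lookup v p) ⟩
  lookup v p + + k * lookup v p      ≡⟨ cong (_+_ (lookup v p)) (lookup-·ᵥ (+ k) v p) ⟨
  lookup v p + lookup ((+ k) ·ᵥ v) p ≡⟨ lookup-+ᵥ v ((+ k) ·ᵥ v) p ⟨
  lookup (v +ᵥ ((+ k) ·ᵥ v)) p       ∎
  where
  open ≡-Reasoning
  unfold : ∀ k x → (+ 1 + k) * x ≡ x + k * x
  unfold = solve-∀

·ᵥ-distribˡ-+ᵥ : ∀ {d} k (u v : Vec ℤ d) → k ·ᵥ (u +ᵥ v) ≡ (k ·ᵥ u) +ᵥ (k ·ᵥ v)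
·ᵥ-distribˡ-+ᵥ k u v = lookup-ext λ p → begin
  lookup (k ·ᵥ (u +ᵥ v)) p              ≡⟨ lookup-·ᵥ k (u +ᵥ v) p ⟩
  k * lookup (u +ᵥ v) p                 ≡⟨ cong (_*_ k) (lookup-+ᵥ u v p) ⟩
  k * (lookup u p + lookup v p)         ≡⟨ ℤP.*-distribˡ-+ k (lookup u p) (lookup v p) ⟩
  k * lookup u p + k * lookup v p       ≡⟨ cong₂ _+_ (lookup-·ᵥ k u p) (lookup-·ᵥ k v p) ⟨
  lookup (k ·ᵥ u) p + lookup (k ·ᵥ v) p ≡⟨ lookup-+ᵥ (k ·ᵥ u) (k ·ᵥ v) p ⟨
  lookup ((k ·ᵥ u) +ᵥ (k ·ᵥ v)) p       ∎
  where open ≡-Reasoning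

·ᵥ-comm : ∀ {d} a b (v : Vec ℤ d) → a ·ᵥ (b ·ᵥ v) ≡ b ·ᵥ (a ·ᵥ v)
·ᵥ-comm a b v = lookup-ext λ p → begin
  lookup (a ·ᵥ (b ·ᵥ v)) p ≡⟨ lookup-·ᵥ a (b ·ᵥ v) p ⟩
  a * lookup (b ·ᵥ v) p    ≡⟨ cong (_*_ a) (lookup-·ᵥ b v p) ⟩
  a * (b * lookup v p)     ≡⟨ swap a b (lookup v p) ⟩
  b * (a * lookup v p)     ≡⟨ cong (_*_ b) (lookup-·ᵥ a v p) ⟨
  b * lookup (a ·ᵥ v) p    ≡⟨ lookup-·ᵥ b (a ·ᵥ v) p ⟨
  lookup (b ·ᵥ (a ·ᵥ v)) p ∎
  where
  open ≡-Reasoning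
  swap : ∀ a b x → a * (b * x) ≡ b * (a * x)
  swap = solve-∀

·ᵥ-cancelˡ : ∀ {d} k .{{_ : ℕ.NonZero k}} (u v : Vec ℤ d) → (+ k) ·ᵥ u ≡ (+ k) ·ᵥ v → u ≡ v
·ᵥ-cancelˡ k u v eq = lookup-ext λ p → ℤP.*-cancelˡ-≡ (+ k) (lookup u p) (lookup v p)
  (trans (sym (lookup-·ᵥ (+ k) u p)) (trans (cong (λ x → lookup x p) eq) (lookup-·ᵥ (+ k) v p)))

lookup-isolate : ∀ {d} k (u v w : Vec ℤ d) → u +ᵥ (k ·ᵥ w) ≡ k ·ᵥ v →
                 ∀ p → lookup u p ≡ (lookup v p - lookup w p) * k
lookup-isolate k u v w eq p = begin
  lookup u p                                     ≡⟨ unfold (lookup u p) k (lookup w p) ⟩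
  (lookup u p + k * lookup w p) - lookup w p * k ≡⟨ cong (λ x → x - lookup w p * k) pointwise ⟩
  k * lookup v p - lookup w p * k                ≡⟨ factor k (lookup v p) (lookup w p) ⟩
  (lookup v p - lookup w p) * k                  ∎
  where
  open ≡-Reasoning
  unfold : ∀ x k y → x ≡ (x + k * y) - y * k
  unfold = solve-∀
  factor : ∀ k y l → k * y - l * k ≡ (y - l) * k
  factor = solve-∀
  pointwise : lookup u p + k * lookup w p ≡ k * lookup v p
  pointwise = begin
    lookup u p + k * lookup w p    ≡⟨ cong (_+_ (lookup u p)) (lookup-·ᵥ k w p) ⟨
    lookup u p + lookup (k ·ᵥ w) p ≡⟨ lookup-+ᵥ u (k ·ᵥ w) p ⟨
    lookup (u +ᵥ (k ·ᵥ w)) p       ≡⟨ cong (λ x → lookup x p) eq ⟩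
    lookup (k ·ᵥ v) p              ≡⟨ lookup-·ᵥ k v p ⟩
    k * lookup v p                 ∎

+ᵥ-identityˡ : ∀ {d} (v : Vec ℤ d) → 0ᵥ +ᵥ v ≡ v
+ᵥ-identityˡ = VP.zipWith-identityˡ ℤP.+-identityˡ

-ᵥ-identityʳ : ∀ {d} (v : Vec ℤ d) → v -ᵥ 0ᵥ ≡ v
-ᵥ-identityʳ v = begin
  v -ᵥ 0ᵥ           ≡⟨ VP.zipWith-replicate₂ _-_ v (+ 0) ⟩
  V.map (_- + 0) v  ≡⟨ VP.map-cong ℤP.+-identityʳ v ⟩
  V.map (λ x → x) v ≡⟨ VP.map-id v ⟩
  v                 ∎
  where open ≡-Reasoning

-ᵥ-as-+ᵥ : ∀ {d} (u v : Vec ℤ d) → u -ᵥ v ≡ u +ᵥ (ℤ.-1ℤ ·ᵥ v)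
-ᵥ-as-+ᵥ u v = lookup-ext λ p → begin
  lookup (u -ᵥ v) p                  ≡⟨ lookup--ᵥ u v p ⟩
  lookup u p - lookup v p            ≡⟨ cong (_+_ (lookup u p)) (ℤP.-1*i≡-i (lookup v p)) ⟨
  lookup u p + ℤ.-1ℤ * lookup v p    ≡⟨ cong (_+_ (lookup u p)) (lookup-·ᵥ ℤ.-1ℤ v p) ⟨
  lookup u p + lookup (ℤ.-1ℤ ·ᵥ v) p ≡⟨ lookup-+ᵥ u (ℤ.-1ℤ ·ᵥ v) p ⟨
  lookup (u +ᵥ (ℤ.-1ℤ ·ᵥ v)) p       ∎
  where open ≡-Reasoning

sum-single : ∀ {m} (f : Fin m → ℤ) j → (∀ i → i ≢ j → f i ≡ + 0) → sum f ≡ f j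
sum-single {suc m} f j others = begin
  sum f                                   ≡⟨ sum-remove {m} {j} f ⟩
  f j + sum {m} (λ i → f (F.punchIn j i)) ≡⟨ cong (_+_ (f j)) (sum-cong-≗ {m} vanish) ⟩
  f j + sum {m} (λ _ → + 0)               ≡⟨ cong (_+_ (f j)) (sum-replicate-zero m) ⟩
  f j + + 0                               ≡⟨ ℤP.+-identityʳ (f j) ⟩
  f j                                     ∎
  where
  open ≡-Reasoning
  vanish : ∀ i → f (F.punchIn j i) ≡ + 0
  vanish i = others (F.punchIn j i) (FP.punchInᵢ≢i j i)

record Linear (d : ℕ) : Set where
  field
    ap   : Vec ℤ d → ℤ
    ap-+ : ∀ u v → ap (u +ᵥ v) ≡ ap u + ap v
    ap-· : ∀ k v → ap (k ·ᵥ v) ≡ k * ap v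
open Linear public

0ₗ : ∀ {d} → Linear d
0ₗ = record { ap = λ _ → + 0 ; ap-+ = λ _ _ → refl ; ap-· = λ k _ → sym (ℤP.*-zeroʳ k) }

coordinate : ∀ {d} → Fin d → Linear d
coordinate p = record
  { ap = λ v → lookup v p ; ap-+ = λ u v → lookup-+ᵥ u v p ; ap-· = λ k v → lookup-·ᵥ k v p }

infixl 6 _+ₗ_
infixl 7 _·ₗ_

_+ₗ_ : ∀ {d} → Linear d → Linear d → Linear d
φ +ₗ ψ = record
  { ap   = λ v → ap φ v + ap ψ v
  ; ap-+ = λ u v → trans (cong₂ _+_ (ap-+ φ u v) (ap-+ ψ u v))
                          (interchange (ap φ u) (ap φ v) (ap ψ u) (ap ψ v))
  ; ap-· = λ k v → trans (cong₂ _+_ (ap-· φ k v) (ap-· ψ k v))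
                          (sym (ℤP.*-distribˡ-+ k (ap φ v) (ap ψ v)))
  }
  where
  interchange : ∀ a b c e → (a + b) + (c + e) ≡ (a + c) + (b + e)
  interchange = solve-∀

_·ₗ_ : ∀ {d} → ℤ → Linear d → Linear d
a ·ₗ φ = record
  { ap   = λ v → a * ap φ v
  ; ap-+ = λ u v → trans (cong (a *_) (ap-+ φ u v)) (ℤP.*-distribˡ-+ a (ap φ u) (ap φ v))
  ; ap-· = λ k v → trans (cong (a *_) (ap-· φ k v)) (swap a k (ap φ v))
  }
  where
  swap : ∀ a k x → a * (k * x) ≡ k * (a * x)
  swap = solve-∀

sumₗ : ∀ {m d} → (Fin m → Linear d) → Linear d
sumₗ φs = record
  { ap   = λ v → sum (λ i → ap (φs i) v)
  ; ap-+ = λ u v → trans (sum-cong-≗ (λ i → ap-+ (φs i) u v))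
                          (∑-distrib-+ (λ i → ap (φs i) u) (λ i → ap (φs i) v))
  ; ap-· = λ k v → trans (sum-cong-≗ (λ i → ap-· (φs i) k v))
                          (sym (*-distribˡ-sum k (λ i → ap (φs i) v)))
  }

ap-0ᵥ : ∀ {d} (φ : Linear d) → ap φ 0ᵥ ≡ + 0
ap-0ᵥ φ = trans (cong (ap φ) (sym (·ᵥ-zeroˡ 0ᵥ))) (ap-· φ (+ 0) 0ᵥ)

ap--ᵥ : ∀ {d} (φ : Linear d) u v → ap φ (u -ᵥ v) ≡ ap φ u - ap φ v
ap--ᵥ φ u v = begin
  ap φ (u -ᵥ v)              ≡⟨ cong (ap φ) (-ᵥ-as-+ᵥ u v) ⟩
  ap φ (u +ᵥ (ℤ.-1ℤ ·ᵥ v))   ≡⟨ ap-+ φ u (ℤ.-1ℤ ·ᵥ v) ⟩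
  ap φ u + ap φ (ℤ.-1ℤ ·ᵥ v) ≡⟨ cong (_+_ (ap φ u)) (ap-· φ ℤ.-1ℤ v) ⟩
  ap φ u + ℤ.-1ℤ * ap φ v    ≡⟨ cong (_+_ (ap φ u)) (ℤP.-1*i≡-i (ap φ v)) ⟩
  ap φ u - ap φ v            ∎
  where open ≡-Reasoning

ap-lincomb : ∀ {m d} (φ : Linear d) (z : Fin m → Vec ℤ d) c →
             ap φ (lincomb z c) ≡ sum (λ j → c j * ap φ (z j))
ap-lincomb {zero}  φ z c = ap-0ᵥ φ
ap-lincomb {suc m} φ z c = trans (ap-+ φ _ _)
  (cong₂ _+_ (ap-· φ (c fzero) (z fzero)) (ap-lincomb φ (z ∘ fsuc) (c ∘ fsuc)))

lincomb-cong : ∀ {m d} (z : Fin m → Vec ℤ d) {c c′} →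
               (∀ i → c i ≡ c′ i) → lincomb z c ≡ lincomb z c′
lincomb-cong z {c} {c′} c≗c′ = lookup-ext λ p → begin
  lookup (lincomb z c) p            ≡⟨ ap-lincomb (coordinate p) z c ⟩
  sum (λ j → c j * lookup (z j) p)  ≡⟨ sum-cong-≗ (λ j → cong (_* lookup (z j) p) (c≗c′ j)) ⟩
  sum (λ j → c′ j * lookup (z j) p) ≡⟨ ap-lincomb (coordinate p) z c′ ⟨
  lookup (lincomb z c′) p           ∎
  where open ≡-Reasoning

lincomb-+ : ∀ {m d} (z : Fin m → Vec ℤ d) c c′ →
            lincomb z (λ i → c i + c′ i) ≡ lincomb z c +ᵥ lincomb z c′
lincomb-+ z c c′ = lookup-ext λ p → begin
  lookup (lincomb z (λ i → c i + c′ i)) p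
    ≡⟨ ap-lincomb (coordinate p) z _ ⟩
  sum (λ j → (c j + c′ j) * lookup (z j) p)
    ≡⟨ sum-cong-≗ (λ j → ℤP.*-distribʳ-+ (lookup (z j) p) (c j) (c′ j)) ⟩
  sum (λ j → c j * lookup (z j) p + c′ j * lookup (z j) p)
    ≡⟨ ∑-distrib-+ (λ j → c j * lookup (z j) p) (λ j → c′ j * lookup (z j) p) ⟩
  sum (λ j → c j * lookup (z j) p) + sum (λ j → c′ j * lookup (z j) p)
    ≡⟨ cong₂ _+_ (ap-lincomb (coordinate p) z c) (ap-lincomb (coordinate p) z c′) ⟨
  lookup (lincomb z c) p + lookup (lincomb z c′) p
    ≡⟨ lookup-+ᵥ (lincomb z c) (lincomb z c′) p ⟨
  lookup (lincomb z c +ᵥ lincomb z c′) p ∎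
  where open ≡-Reasoning

lincomb-· : ∀ {m d} (z : Fin m → Vec ℤ d) k c → lincomb z (λ i → k * c i) ≡ k ·ᵥ lincomb z c
lincomb-· z k c = lookup-ext λ p → begin
  lookup (lincomb z (λ i → k * c i)) p
    ≡⟨ ap-lincomb (coordinate p) z _ ⟩
  sum (λ j → k * c j * lookup (z j) p)
    ≡⟨ sum-cong-≗ (λ j → ℤP.*-assoc k (c j) (lookup (z j) p)) ⟩
  sum (λ j → k * (c j * lookup (z j) p))
    ≡⟨ *-distribˡ-sum k (λ j → c j * lookup (z j) p) ⟨
  k * sum (λ j → c j * lookup (z j) p)
    ≡⟨ cong (_*_ k) (ap-lincomb (coordinate p) z c) ⟨
  k * lookup (lincomb z c) p
    ≡⟨ lookup-·ᵥ k (lincomb z c) p ⟨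
  lookup (k ·ᵥ lincomb z c) p ∎
  where open ≡-Reasoning

lincomb-zero : ∀ {m d} (z : Fin m → Vec ℤ d) {c} → (∀ i → c i ≡ + 0) → lincomb z c ≡ 0ᵥ
lincomb-zero z {c} c≗0 = begin
  lincomb z c                    ≡⟨ lincomb-cong z c≗0 ⟩
  lincomb z (λ _ → + 0 * + 0)    ≡⟨ lincomb-· z (+ 0) (λ _ → + 0) ⟩
  (+ 0) ·ᵥ lincomb z (λ _ → + 0) ≡⟨ ·ᵥ-zeroˡ _ ⟩
  0ᵥ                             ∎
  where open ≡-Reasoning

-- Scaled dual bases

record DualBasis {m d} (z : Fin m → Vec ℤ d) (A : Subset m) : Set where
  field
    N         : ℕ
    {{N≢0}}   : ℕ.NonZero N
    φ         : Fin m → Linear d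
    φ-outside : ∀ i → i ∉ A → ∀ v → ap (φ i) v ≡ + 0
    φ-diag    : ∀ i → i ∈ A → ap (φ i) (z i) ≡ + N
    φ-offdiag : ∀ i j → j ∈ A → i ≢ j → ap (φ i) (z j) ≡ + 0

module Extension {m d} (z : Fin (suc m) → Vec ℤ d) {A : Subset m} (B : DualBasis (z ∘ fsuc) A) where
  open DualBasis B
  open Realized z using (RankCond)

  z₀ : Vec ℤ d
  z₀ = z fzero

  skip : DualBasis z (false ∷ A)
  skip = record { N = N ; φ = φ′ ; φ-outside = outside ; φ-diag = diag ; φ-offdiag = offdiag }
    where
    φ′ : Fin (suc m) → Linear d
    φ′ fzero    = 0ₗ
    φ′ (fsuc i) = φ i
    outside : ∀ i → i ∉ false ∷ A → ∀ v → ap (φ′ i) v ≡ + 0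
    outside fzero    _  v = refl
    outside (fsuc i) i∉ v = φ-outside i (i∉ ∘ there) v
    diag : ∀ i → i ∈ false ∷ A → ap (φ′ i) (z i) ≡ + N
    diag (fsuc i) (there i∈) = φ-diag i i∈
    offdiag : ∀ i j → j ∈ false ∷ A → i ≢ j → ap (φ′ i) (z j) ≡ + 0
    offdiag fzero    (fsuc j) _          _   = refl
    offdiag (fsuc i) (fsuc j) (there j∈) i≢j = φ-offdiag i j j∈ (i≢j ∘ cong fsuc)

  -- the p-th coordinate of N v − Σ_i φ_i(v) z_{i+1}: it kills every old vector, and it kills
  -- z₀ for all p only if z₀ depends on them
  residual : Fin d → Linear d
  residual p = (+ N) ·ₗ coordinate p +ₗ sumₗ (λ i → (- lookup (z (fsuc i)) p) ·ₗ φ i)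

  residual-span : ∀ p j → j ∈ A → ap (residual p) (z (fsuc j)) ≡ + 0
  residual-span p j j∈ = begin
    + N * x + sum (λ i → (- lookup (z (fsuc i)) p) * ap (φ i) (z (fsuc j)))
      ≡⟨ cong (_+_ (+ N * x)) (sum-single _ j others) ⟩
    + N * x + (- x) * ap (φ j) (z (fsuc j))
      ≡⟨ cong (λ y → + N * x + (- x) * y) (φ-diag j j∈) ⟩
    + N * x + (- x) * + N
      ≡⟨ cancel (+ N) x ⟩
    + 0 ∎
    where
    open ≡-Reasoning
    x = lookup (z (fsuc j)) p
    others : ∀ i → i ≢ j → (- lookup (z (fsuc i)) p) * ap (φ i) (z (fsuc j)) ≡ + 0
    others i i≢j = trans (cong (_*_ (- lookup (z (fsuc i)) p)) (φ-offdiag i j j∈ i≢j))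
                         (ℤP.*-zeroʳ (- lookup (z (fsuc i)) p))
    cancel : ∀ a x → a * x + (- x) * a ≡ + 0
    cancel = solve-∀

  residual-vanishing⇒dependent : (∀ p → ap (residual p) z₀ ≡ + 0) → ¬ RankCond (true ∷ A)
  residual-vanishing⇒dependent vanish rank =
    ℕ.≢-nonZero⁻¹ N (ℤP.+-injective (rank c c-supported c-relation fzero))
    where
    c : Fin (suc m) → ℤ
    c fzero    = + N
    c (fsuc i) = - ap (φ i) z₀
    c-supported : ∀ i → i ∉ true ∷ A → c i ≡ + 0
    c-supported fzero    i∉ = ⊥-elim (i∉ here)
    c-supported (fsuc i) i∉ = cong -_ (φ-outside i (i∉ ∘ there) z₀)
    swap : ∀ a b → (- a) * b ≡ (- b) * a
    swap = solve-∀
    c-relation : lincomb z c ≡ 0ᵥ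
    c-relation = lookup-ext λ p → begin
      lookup (lincomb z c) p
        ≡⟨ ap-lincomb (coordinate p) z c ⟩
      + N * lookup z₀ p + sum (λ i → (- ap (φ i) z₀) * lookup (z (fsuc i)) p)
        ≡⟨ cong (_+_ (+ N * lookup z₀ p)) (sum-cong-≗ λ i → swap (ap (φ i) z₀) (lookup (z (fsuc i)) p)) ⟩
      ap (residual p) z₀
        ≡⟨ vanish p ⟩
      + 0
        ≡⟨ lookup-0ᵥ p ⟨
      lookup 0ᵥ p ∎
      where open ≡-Reasoning

  adjoin : (ψ : Linear d) (M : ℕ) .{{_ : ℕ.NonZero M}} → ap ψ z₀ ≡ + M →
           (∀ j → j ∈ A → ap ψ (z (fsuc j)) ≡ + 0) → DualBasis z (true ∷ A)
  adjoin ψ M ψ-z₀ ψ-span = record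
    { N = N ℕ.* M ; N≢0 = ℕP.m*n≢0 N M ; φ = φ′
    ; φ-outside = outside ; φ-diag = diag ; φ-offdiag = offdiag
    }
    where
    -- each old φ_i is rescaled by M and corrected by a multiple of ψ so that it vanishes on z₀
    φ′ : Fin (suc m) → Linear d
    φ′ fzero    = (+ N) ·ₗ ψ
    φ′ (fsuc i) = (+ M) ·ₗ φ i +ₗ (- ap (φ i) z₀) ·ₗ ψ
    NM : + N * + M ≡ + (N ℕ.* M)
    NM = sym (ℤP.pos-* N M)
    vanishes : ∀ a x y → a * + 0 + (- x) * y ≡ (- x) * y
    vanishes = solve-∀
    outside : ∀ i → i ∉ true ∷ A → ∀ v → ap (φ′ i) v ≡ + 0
    outside fzero    i∉ v = ⊥-elim (i∉ here)
    outside (fsuc i) i∉ v = begin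
      + M * ap (φ i) v + (- ap (φ i) z₀) * ap ψ v
        ≡⟨ cong₂ (λ a b → + M * a + (- b) * ap ψ v) (φ-outside i i∉′ v) (φ-outside i i∉′ z₀) ⟩
      + M * + 0 + (- + 0) * ap ψ v
        ≡⟨ vanishes (+ M) (+ 0) (ap ψ v) ⟩
      + 0 ∎
      where
      open ≡-Reasoning
      i∉′ = i∉ ∘ there
    diag : ∀ i → i ∈ true ∷ A → ap (φ′ i) (z i) ≡ + (N ℕ.* M)
    diag fzero    _          = trans (cong (_*_ (+ N)) ψ-z₀) NM
    diag (fsuc i) (there i∈) = begin
      + M * ap (φ i) (z (fsuc i)) + (- ap (φ i) z₀) * ap ψ (z (fsuc i))
        ≡⟨ cong₂ (λ a b → + M * a + (- ap (φ i) z₀) * b) (φ-diag i i∈) (ψ-span i i∈) ⟩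
      + M * + N + (- ap (φ i) z₀) * + 0
        ≡⟨ cong (_+_ (+ M * + N)) (ℤP.*-zeroʳ (- ap (φ i) z₀)) ⟩
      + M * + N + + 0
        ≡⟨ ℤP.+-identityʳ (+ M * + N) ⟩
      + M * + N
        ≡⟨ trans (ℤP.*-comm (+ M) (+ N)) NM ⟩
      + (N ℕ.* M) ∎
      where open ≡-Reasoning
    offdiag : ∀ i j → j ∈ true ∷ A → i ≢ j → ap (φ′ i) (z j) ≡ + 0
    offdiag fzero    fzero    _          i≢j = ⊥-elim (i≢j refl)
    offdiag fzero    (fsuc j) (there j∈) _   = trans (cong (_*_ (+ N)) (ψ-span j j∈)) (ℤP.*-zeroʳ (+ N))
    offdiag (fsuc i) fzero    _          _   =
      trans (cong (λ b → + M * ap (φ i) z₀ + (- ap (φ i) z₀) * b) ψ-z₀)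
            (cancel (+ M) (ap (φ i) z₀))
      where
      cancel : ∀ a x → a * x + (- x) * a ≡ + 0
      cancel = solve-∀
    offdiag (fsuc i) (fsuc j) (there j∈) i≢j = begin
      + M * ap (φ i) (z (fsuc j)) + (- ap (φ i) z₀) * ap ψ (z (fsuc j))
        ≡⟨ cong₂ (λ a b → + M * a + (- ap (φ i) z₀) * b) (φ-offdiag i j j∈ (i≢j ∘ cong fsuc))
                                                        (ψ-span j j∈) ⟩
      + M * + 0 + (- ap (φ i) z₀) * + 0
        ≡⟨ vanishes (+ M) (ap (φ i) z₀) (+ 0) ⟩
      (- ap (φ i) z₀) * + 0
        ≡⟨ ℤP.*-zeroʳ (- ap (φ i) z₀) ⟩
      + 0 ∎
      where open ≡-Reasoning

  adjoin-or-dependent : DualBasis z (true ∷ A) ⊎ ¬ RankCond (true ∷ A)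
  adjoin-or-dependent with FP.all? (λ p → ap (residual p) z₀ ℤ.≟ + 0)
  ... | yes vanish = inj₂ (residual-vanishing⇒dependent vanish)
  ... | no ¬vanish with FP.¬∀⟶∃¬ d _ (λ p → ap (residual p) z₀ ℤ.≟ + 0) ¬vanish
  ...   | p , residual≢0 with ap (residual p) z₀ in eq
  ...     | + zero   = ⊥-elim (residual≢0 refl)
  ...     | + suc t  = inj₁ (adjoin (residual p) (suc t) eq (residual-span p))
  ...     | -[1+ t ] = inj₁ (adjoin (ℤ.-1ℤ ·ₗ residual p) (suc t)
                               (trans (cong (_*_ ℤ.-1ℤ) eq) (ℤP.-1*i≡-i -[1+ t ]))
                               (λ j j∈ → cong (_*_ ℤ.-1ℤ) (residual-span p j j∈)))

rankCond-tail : ∀ {m d} (z : Fin (suc m) → Vec ℤ d) {b A} →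
                Realized.RankCond z (b ∷ A) → Realized.RankCond (z ∘ fsuc) A
rankCond-tail z {b} {A} rank c c-supported relation i = rank c′ c′-supported c′-relation (fsuc i)
  where
  c′ : Fin (suc _) → ℤ
  c′ fzero    = + 0
  c′ (fsuc i) = c i
  c′-supported : ∀ i → i ∉ b ∷ A → c′ i ≡ + 0
  c′-supported fzero    _  = refl
  c′-supported (fsuc i) i∉ = c-supported i (i∉ ∘ there)
  c′-relation : lincomb z c′ ≡ 0ᵥ
  c′-relation = trans (cong₂ _+ᵥ_ (·ᵥ-zeroˡ (z fzero)) relation) (+ᵥ-identityˡ 0ᵥ)

dualBasis-or-dependent : ∀ {m d} (z : Fin m → Vec ℤ d) A → DualBasis z A ⊎ ¬ Realized.RankCond z A
dualBasis-or-dependent z [] = inj₁ record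
  { N = 1 ; φ = λ () ; φ-outside = λ () ; φ-diag = λ () ; φ-offdiag = λ () }
dualBasis-or-dependent z (b ∷ A) with dualBasis-or-dependent (z ∘ fsuc) A
... | inj₂ dependent = inj₂ (dependent ∘ rankCond-tail z)
... | inj₁ B with b
...   | false = inj₁ (Extension.skip z B)
...   | true  = Extension.adjoin-or-dependent z B

module Torsion {n d} (z : Fin n → Vec ℤ d) {A : Subset n} (B : DualBasis z A) where
  open Realized z
  open DualBasis B

  coords : Vec ℤ d → Fin n → ℤ
  coords v i = ap (φ i) v

  coords-supported : ∀ v → SupportedOn A (coords v)
  coords-supported v i i∉ = φ-outside i i∉ v

  φ-lincomb : ∀ c → SupportedOn A c → ∀ i → ap (φ i) (lincomb z c) ≡ c i * + N
  φ-lincomb c c-supported i with i SSP.∈? A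
  ... | yes i∈ = begin
    ap (φ i) (lincomb z c)           ≡⟨ ap-lincomb (φ i) z c ⟩
    sum (λ j → c j * ap (φ i) (z j)) ≡⟨ sum-single _ i others ⟩
    c i * ap (φ i) (z i)             ≡⟨ cong (_*_ (c i)) (φ-diag i i∈) ⟩
    c i * + N                        ∎
    where
    open ≡-Reasoning
    others : ∀ j → j ≢ i → c j * ap (φ i) (z j) ≡ + 0
    others j j≢i with j SSP.∈? A
    ... | yes j∈ = trans (cong (_*_ (c j)) (φ-offdiag i j j∈ (j≢i ∘ sym))) (ℤP.*-zeroʳ (c j))
    ... | no  j∉ = cong (_* ap (φ i) (z j)) (c-supported j j∉)
  ... | no  i∉ = trans (φ-outside i i∉ _) (sym (cong (_* + N) (c-supported i i∉)))

  rankCond : RankCond A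
  rankCond c c-supported relation i = ℤP.*-cancelʳ-≡ (c i) (+ 0) (+ N) (begin
    c i * + N              ≡⟨ φ-lincomb c c-supported i ⟨
    ap (φ i) (lincomb z c) ≡⟨ cong (ap (φ i)) relation ⟩
    ap (φ i) 0ᵥ            ≡⟨ ap-0ᵥ (φ i) ⟩
    + 0                    ∎)
    where open ≡-Reasoning

  inSpan⇒coords : ∀ {u} (u∈ : InSpan A u) i → coords u i ≡ proj₁ u∈ i * + N
  inSpan⇒coords (c , c-supported , refl) = φ-lincomb c c-supported

  torsion-decomposition : ∀ {v} → IsTors A v → (+ N) ·ᵥ v ≡ lincomb z (coords v)
  torsion-decomposition {v} (k , k≢0 , kv∈@(c , c-supported , c-kv)) = ·ᵥ-cancelˡ k {{k≢0}} _ _ (begin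
    (+ k) ·ᵥ ((+ N) ·ᵥ v)              ≡⟨ ·ᵥ-comm (+ k) (+ N) v ⟩
    (+ N) ·ᵥ ((+ k) ·ᵥ v)              ≡⟨ cong ((+ N) ·ᵥ_) c-kv ⟨
    (+ N) ·ᵥ lincomb z c               ≡⟨ lincomb-· z (+ N) c ⟨
    lincomb z (λ i → + N * c i)        ≡⟨ lincomb-cong z k-coords ⟩
    lincomb z (λ i → + k * coords v i) ≡⟨ lincomb-· z (+ k) (coords v) ⟩
    (+ k) ·ᵥ lincomb z (coords v)      ∎)
    where
    open ≡-Reasoning
    k-coords : ∀ i → + N * c i ≡ + k * coords v i
    k-coords i = begin
      + N * c i             ≡⟨ ℤP.*-comm (+ N) (c i) ⟩
      c i * + N             ≡⟨ inSpan⇒coords kv∈ i ⟨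
      coords ((+ k) ·ᵥ v) i ≡⟨ ap-· (φ i) (+ k) v ⟩
      + k * coords v i      ∎

  decomposition⇒torsion : ∀ {v} → (+ N) ·ᵥ v ≡ lincomb z (coords v) → IsTors A v
  decomposition⇒torsion {v} eq = N , N≢0 , coords v , coords-supported v , sym eq

  coords⇒inSpan : ∀ {u} → IsTors A u → (q : Fin n → ℤ) →
                  (∀ i → coords u i ≡ q i * + N) → InSpan A u
  coords⇒inSpan {u} u-tors q u-coords = q , q-supported , ·ᵥ-cancelˡ N _ _ (begin
    (+ N) ·ᵥ lincomb z q        ≡⟨ lincomb-· z (+ N) q ⟨
    lincomb z (λ i → + N * q i) ≡⟨ lincomb-cong z (λ i → trans (ℤP.*-comm (+ N) (q i)) (sym (u-coords i))) ⟩
    lincomb z (coords u)        ≡⟨ torsion-decomposition u-tors ⟨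
    (+ N) ·ᵥ u                  ∎)
    where
    open ≡-Reasoning
    q-supported : SupportedOn A q
    q-supported i i∉ = ℤP.*-cancelʳ-≡ (q i) (+ 0) (+ N) (trans (sym (u-coords i)) (coords-supported u i i∉))

  tors-+ : ∀ {v w} → IsTors A v → IsTors A w → IsTors A (v +ᵥ w)
  tors-+ {v} {w} v-tors w-tors = decomposition⇒torsion (begin
    (+ N) ·ᵥ (v +ᵥ w)                            ≡⟨ ·ᵥ-distribˡ-+ᵥ (+ N) v w ⟩
    ((+ N) ·ᵥ v) +ᵥ ((+ N) ·ᵥ w)                 ≡⟨ cong₂ _+ᵥ_ (torsion-decomposition v-tors)
                                                                (torsion-decomposition w-tors) ⟩
    lincomb z (coords v) +ᵥ lincomb z (coords w) ≡⟨ lincomb-+ z (coords v) (coords w) ⟨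
    lincomb z (λ i → coords v i + coords w i)    ≡⟨ lincomb-cong z (λ i → sym (ap-+ (φ i) v w)) ⟩
    lincomb z (coords (v +ᵥ w))                  ∎)
    where open ≡-Reasoning

  tors-· : ∀ a {v} → IsTors A v → IsTors A (a ·ᵥ v)
  tors-· a {v} v-tors = decomposition⇒torsion (begin
    (+ N) ·ᵥ (a ·ᵥ v)                ≡⟨ ·ᵥ-comm (+ N) a v ⟩
    a ·ᵥ ((+ N) ·ᵥ v)                ≡⟨ cong (a ·ᵥ_) (torsion-decomposition v-tors) ⟩
    a ·ᵥ lincomb z (coords v)        ≡⟨ lincomb-· z a (coords v) ⟨
    lincomb z (λ i → a * coords v i) ≡⟨ lincomb-cong z (λ i → sym (ap-· (φ i) a v)) ⟩
    lincomb z (coords (a ·ᵥ v))      ∎)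
    where open ≡-Reasoning

  tors-- : ∀ {v w} → IsTors A v → IsTors A w → IsTors A (v -ᵥ w)
  tors-- {v} {w} v-tors w-tors =
    subst (IsTors A) (sym (-ᵥ-as-+ᵥ v w)) (tors-+ v-tors (tors-· ℤ.-1ℤ w-tors))

module Remainders (N : ℕ) .{{_ : ℕ.NonZero N}} where

  private
    no-wraparound : ∀ {a b} j → a ℕ.< N → + a ≢ + b + + suc j * + N
    no-wraparound {a} {b} j a<N eq = ℕP.<⇒≱ a<N (begin
      N                   ≤⟨ ℕP.m≤m+n N (j ℕ.* N) ⟩
      suc j ℕ.* N         ≤⟨ ℕP.m≤n+m (suc j ℕ.* N) b ⟩
      b ℕ.+ suc j ℕ.* N ≡⟨ ℤP.+-injective (sym (trans eq as-ℕ)) ⟩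
      a                 ∎)
      where
      open ℕP.≤-Reasoning
      as-ℕ : + b + + suc j * + N ≡ + (b ℕ.+ suc j ℕ.* N)
      as-ℕ = trans (cong (_+_ (+ b)) (sym (ℤP.pos-* (suc j) N))) (sym (ℤP.pos-+ b (suc j ℕ.* N)))

  remainder-unique : ∀ {a b} q → a ℕ.< N → b ℕ.< N → + a ≡ + b + q * + N → a ≡ b
  remainder-unique {a} {b} (+ zero)  _   _   eq = ℤP.+-injective (trans eq (ℤP.+-identityʳ (+ b)))
  remainder-unique         (+ suc j) a<N _   eq = ⊥-elim (no-wraparound j a<N eq)
  remainder-unique {a} {b} -[1+ j ]  _   b<N eq = ⊥-elim (no-wraparound j b<N (begin
    + b                                    ≡⟨ move (+ b) (+ suc j) (+ N) ⟩
    (+ b + -[1+ j ] * + N) + + suc j * + N ≡⟨ cong (λ x → x + + suc j * + N) eq ⟨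
    + a + + suc j * + N                    ∎))
    where
    open ≡-Reasoning
    move : ∀ b t n → b ≡ (b + (- t) * n) + t * n
    move = solve-∀

  %ℕ-+multiple : ∀ b q → (b + q * + N) %ℕ N ≡ b %ℕ N
  %ℕ-+multiple b q = remainder-unique ((b /ℕ N) + q - (a /ℕ N)) (n%ℕd<d a N) (n%ℕd<d b N) (begin
    + (a %ℕ N)                                        ≡⟨ shift (+ (a %ℕ N)) (a /ℕ N) (+ N) ⟩
    (+ (a %ℕ N) + (a /ℕ N) * + N) - (a /ℕ N) * + N    ≡⟨ cong (_- (a /ℕ N) * + N) (a≡a%ℕn+[a/ℕn]*n a N) ⟨
    b + q * + N - (a /ℕ N) * + N
      ≡⟨ cong (λ x → x + q * + N - (a /ℕ N) * + N) (a≡a%ℕn+[a/ℕn]*n b N) ⟩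
    (+ (b %ℕ N) + (b /ℕ N) * + N) + q * + N - (a /ℕ N) * + N
      ≡⟨ collect (+ (b %ℕ N)) (b /ℕ N) q (a /ℕ N) (+ N) ⟩
    + (b %ℕ N) + ((b /ℕ N) + q - (a /ℕ N)) * + N      ∎)
    where
    open ≡-Reasoning
    a = b + q * + N
    shift : ∀ r x n → r ≡ (r + x * n) - x * n
    shift = solve-∀
    collect : ∀ r x q y n → (r + x * n) + q * n - y * n ≡ r + (x + q - y) * n
    collect = solve-∀

  %ℕ-injective : ∀ a b → a %ℕ N ≡ b %ℕ N → ∃[ q ] a ≡ b + q * + N
  %ℕ-injective a b eq = (a /ℕ N) - (b /ℕ N) , (begin
    a                                                  ≡⟨ a≡a%ℕn+[a/ℕn]*n a N ⟩
    + (a %ℕ N) + (a /ℕ N) * + N                        ≡⟨ cong (λ r → + r + (a /ℕ N) * + N) eq ⟩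
    + (b %ℕ N) + (a /ℕ N) * + N                        ≡⟨ regroup (+ (b %ℕ N)) (a /ℕ N) (b /ℕ N) (+ N) ⟩
    (+ (b %ℕ N) + (b /ℕ N) * + N) + ((a /ℕ N) - (b /ℕ N)) * + N
      ≡⟨ cong (_+ ((a /ℕ N) - (b /ℕ N)) * + N) (a≡a%ℕn+[a/ℕn]*n b N) ⟨
    b + ((a /ℕ N) - (b /ℕ N)) * + N                    ∎)
    where
    open ≡-Reasoning
    regroup : ∀ r x y n → r + x * n ≡ (r + y * n) + (x - y) * n
    regroup = solve-∀

  %ℕ≡0⇒ : ∀ a → a %ℕ N ≡ 0 → a ≡ (a /ℕ N) * + N
  %ℕ≡0⇒ a eq = begin
    a                           ≡⟨ a≡a%ℕn+[a/ℕn]*n a N ⟩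
    + (a %ℕ N) + (a /ℕ N) * + N ≡⟨ cong (λ r → + r + (a /ℕ N) * + N) eq ⟩
    + 0 + (a /ℕ N) * + N        ≡⟨ ℤP.+-identityˡ ((a /ℕ N) * + N) ⟩
    (a /ℕ N) * + N              ∎
    where open ≡-Reasoning

  multiple⇒%ℕ≡0 : ∀ a q → a ≡ q * + N → a %ℕ N ≡ 0
  multiple⇒%ℕ≡0 a q a≡qN = begin
    a %ℕ N               ≡⟨ cong (_%ℕ N) (trans a≡qN (sym (ℤP.+-identityˡ (q * + N)))) ⟩
    (+ 0 + q * + N) %ℕ N ≡⟨ %ℕ-+multiple (+ 0) q ⟩
    0 ℕ.% N              ≡⟨ ℕD.m*n%n≡0 0 N ⟩
    0                    ∎
    where open ≡-Reasoning

  residue : ℤ → Fin N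
  residue a = F.fromℕ< (n%ℕd<d a N)

  toℕ-residue : ∀ a → F.toℕ (residue a) ≡ a %ℕ N
  toℕ-residue a = FP.toℕ-fromℕ< (n%ℕd<d a N)

  residue-+multiple : ∀ b q → residue (b + q * + N) ≡ residue b
  residue-+multiple b q = FP.toℕ-injective (begin
    F.toℕ (residue (b + q * + N)) ≡⟨ toℕ-residue (b + q * + N) ⟩
    (b + q * + N) %ℕ N            ≡⟨ %ℕ-+multiple b q ⟩
    b %ℕ N                        ≡⟨ toℕ-residue b ⟨
    F.toℕ (residue b)             ∎)
    where open ≡-Reasoning

  residue-injective : ∀ a b → residue a ≡ residue b → ∃[ q ] a ≡ b + q * + N
  residue-injective a b eq = %ℕ-injective a b (begin
    a %ℕ N            ≡⟨ toℕ-residue a ⟨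
    F.toℕ (residue a) ≡⟨ cong F.toℕ eq ⟩
    F.toℕ (residue b) ≡⟨ toℕ-residue b ⟩
    b %ℕ N            ∎)
    where open ≡-Reasoning

  residue-toℕ : ∀ (r : Fin N) → residue (+ F.toℕ r) ≡ r
  residue-toℕ r = FP.toℕ-injective (trans (toℕ-residue (+ F.toℕ r)) (ℕD.m<n⇒m%n≡m (FP.toℕ<n r)))

ℚ-ring : ACR.AlmostCommutativeRing _ _
ℚ-ring = ACR.fromCommutativeRing ℚP.+-*-commutativeRing (λ x → dec⇒maybe (0ℚ ℚP.≟ x))

ι : ℤ → ℚ
ι m = m ℚ./ 1

toℚᵘ-ι : ∀ a → toℚᵘ (ι a) ℚᵘ.≃ mkℚᵘ a 0
toℚᵘ-ι a = ℚP.toℚᵘ-fromℚᵘ (mkℚᵘ a 0)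

ι-+ : ∀ a b → ι (a + b) ≡ ι a ℚ.+ ι b
ι-+ a b = ℚP.toℚᵘ-injective (begin
  toℚᵘ (ι (a + b))           ≈⟨ toℚᵘ-ι (a + b) ⟩
  mkℚᵘ (a + b) 0             ≈⟨ *≡* (cross a b) ⟩
  mkℚᵘ a 0 ℚᵘ.+ mkℚᵘ b 0     ≈⟨ ℚᵘP.+-cong (toℚᵘ-ι a) (toℚᵘ-ι b) ⟨
  toℚᵘ (ι a) ℚᵘ.+ toℚᵘ (ι b) ≈⟨ ℚP.toℚᵘ-homo-+ (ι a) (ι b) ⟨
  toℚᵘ (ι a ℚ.+ ι b)         ∎)
  where
  open ℚᵘP.≃-Reasoning
  cross : ∀ a b → (a + b) * + 1 ≡ (a * + 1 + b * + 1) * + 1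
  cross = solve-∀

ι-* : ∀ a b → ι (a * b) ≡ ι a ℚ.* ι b
ι-* a b = ℚP.toℚᵘ-injective (begin
  toℚᵘ (ι (a * b))           ≈⟨ toℚᵘ-ι (a * b) ⟩
  mkℚᵘ (a * b) 0             ≈⟨ ℚᵘP.*-cong (toℚᵘ-ι a) (toℚᵘ-ι b) ⟨
  toℚᵘ (ι a) ℚᵘ.* toℚᵘ (ι b) ≈⟨ ℚP.toℚᵘ-homo-* (ι a) (ι b) ⟨
  toℚᵘ (ι a ℚ.* ι b)         ∎)
  where open ℚᵘP.≃-Reasoning

ι-neg : ∀ a → ι (- a) ≡ ℚ.- ι a
ι-neg a = ℚP.toℚᵘ-injective (begin
  toℚᵘ (ι (- a))  ≈⟨ toℚᵘ-ι (- a) ⟩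
  mkℚᵘ (- a) 0    ≈⟨ ℚᵘP.-‿cong (toℚᵘ-ι a) ⟨
  ℚᵘ.- toℚᵘ (ι a) ≈⟨ ℚP.toℚᵘ-homo‿- (ι a) ⟨
  toℚᵘ (ℚ.- ι a)  ∎)
  where open ℚᵘP.≃-Reasoning

↥-ι : ∀ m → ℚ.↥ (ι m) ≡ m
↥-ι m = begin
  ℚ.↥ (ι m)               ≡⟨ ℤP.*-identityʳ (ℚ.↥ (ι m)) ⟨
  ℚ.↥ (ι m) * + 1         ≡⟨ cong (_*_ (ℚ.↥ (ι m))) (gcd-zeroʳ m) ⟨
  ℚ.↥ (ι m) * gcd m (+ 1) ≡⟨ ℚP.↥-/ m 1 ⟩
  m                       ∎
  where open ≡-Reasoning

≈ℚ/ℤ-refl : ∀ {q} → q ≈ℚ/ℤ q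
≈ℚ/ℤ-refl {q} = + 0 , ℚP.+-inverseʳ q

≈ℚ/ℤ-sym : ∀ {q r} → q ≈ℚ/ℤ r → r ≈ℚ/ℤ q
≈ℚ/ℤ-sym {q} {r} (m , q-r) = - m , (begin
  r ℚ.- q       ≡⟨ flip q r ⟩
  ℚ.- (q ℚ.- r) ≡⟨ cong ℚ.-_ q-r ⟩
  ℚ.- ι m       ≡⟨ ι-neg m ⟨
  ι (- m)       ∎)
  where
  open ≡-Reasoning
  flip : ∀ q r → r ℚ.- q ≡ ℚ.- (q ℚ.- r)
  flip = RS.solve-∀ ℚ-ring

≈ℚ/ℤ-trans : ∀ {q r s} → q ≈ℚ/ℤ r → r ≈ℚ/ℤ s → q ≈ℚ/ℤ s
≈ℚ/ℤ-trans {q} {r} {s} (m , q-r) (m′ , r-s) = m + m′ , (begin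
  q ℚ.- s                 ≡⟨ telescope q r s ⟩
  (q ℚ.- r) ℚ.+ (r ℚ.- s) ≡⟨ cong₂ ℚ._+_ q-r r-s ⟩
  ι m ℚ.+ ι m′            ≡⟨ ι-+ m m′ ⟨
  ι (m + m′)              ∎)
  where
  open ≡-Reasoning
  telescope : ∀ q r s → q ℚ.- s ≡ (q ℚ.- r) ℚ.+ (r ℚ.- s)
  telescope = RS.solve-∀ ℚ-ring

≈ℚ/ℤ-+ : ∀ {q q′ r r′} → q ≈ℚ/ℤ q′ → r ≈ℚ/ℤ r′ → (q ℚ.+ r) ≈ℚ/ℤ (q′ ℚ.+ r′)
≈ℚ/ℤ-+ {q} {q′} {r} {r′} (m , q-q′) (m′ , r-r′) = m + m′ , (begin
  (q ℚ.+ r) ℚ.- (q′ ℚ.+ r′) ≡⟨ interchange q q′ r r′ ⟩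
  (q ℚ.- q′) ℚ.+ (r ℚ.- r′) ≡⟨ cong₂ ℚ._+_ q-q′ r-r′ ⟩
  ι m ℚ.+ ι m′              ≡⟨ ι-+ m m′ ⟨
  ι (m + m′)                ∎)
  where
  open ≡-Reasoning
  interchange : ∀ q q′ r r′ → (q ℚ.+ r) ℚ.- (q′ ℚ.+ r′) ≡ (q ℚ.- q′) ℚ.+ (r ℚ.- r′)
  interchange = RS.solve-∀ ℚ-ring

≈ℚ/ℤ-reflexive : ∀ {q r} → q ≡ r → q ≈ℚ/ℤ r
≈ℚ/ℤ-reflexive {q} refl = ≈ℚ/ℤ-refl {q}

-- _≈ℚ/ℤ_ unfolds to a Σ-type over q ℚ.- r, from which Agda cannot recover q and r,
-- so the rationals are passed explicitly wherever they are implicit.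
ℚ/ℤ-setoid : Setoid _ _
ℚ/ℤ-setoid = record
  { Carrier = ℚ ; _≈_ = _≈ℚ/ℤ_
  ; isEquivalence = record
    { refl  = λ {q} → ≈ℚ/ℤ-refl {q}
    ; sym   = λ {q} {r} → ≈ℚ/ℤ-sym {q} {r}
    ; trans = λ {q} {r} {s} → ≈ℚ/ℤ-trans {q} {r} {s}
    }
  }

module ℚ/ℤ-Reasoning = Relation.Binary.Reasoning.Setoid ℚ/ℤ-setoid

_≈ℚ/ℤ?_ : ∀ q r → Dec (q ≈ℚ/ℤ r)
q ≈ℚ/ℤ? r = map′ (λ q-r → ℚ.↥ (q ℚ.- r) , q-r) integral ((q ℚ.- r) ℚP.≟ ι (ℚ.↥ (q ℚ.- r)))
  where
  integral : q ≈ℚ/ℤ r → q ℚ.- r ≡ ι (ℚ.↥ (q ℚ.- r))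
  integral (m , q-r) = trans q-r (cong ι (sym (trans (cong ℚ.↥_ q-r) (↥-ι m))))

module Fractions (N : ℕ) .{{_ : ℕ.NonZero N}} where
  open Remainders N

  private
    n : ℚ
    n = ι (+ N)

    instance
      n≢0 : ℚ.NonZero n
      n≢0 = ℚ.≢-nonZero {n} λ n≡0 →
        ℕ.≢-nonZero⁻¹ N (ℤP.+-injective (trans (sym (↥-ι (+ N))) (cong ℚ.↥_ n≡0)))

    u : ℚ
    u = ℚ.1/ n

  frac : Fin N → ℚ
  frac t = ι (+ F.toℕ t) ℚ.* u

  -- From n q = m = r + k n, the difference q − r / n is the integer k.
  N-torsion⇒frac : ∀ q → (n ℚ.* q) ≈ℚ/ℤ 0ℚ → ∃[ t ] q ≈ℚ/ℤ frac t
  N-torsion⇒frac q (m , nq≡m) = residue m , m /ℕ N , (begin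
    q ℚ.- r ℚ.* u
      ≡⟨ expand q r n u ⟩
    u ℚ.* (n ℚ.* q ℚ.- 0ℚ) ℚ.- r ℚ.* u ℚ.+ q ℚ.* (1ℚ ℚ.- n ℚ.* u)
      ≡⟨ cong₂ (λ a b → u ℚ.* a ℚ.- r ℚ.* u ℚ.+ q ℚ.* (1ℚ ℚ.- b))
               (trans nq≡m m-split) (ℚP.*-inverseʳ n) ⟩
    u ℚ.* (r ℚ.+ k ℚ.* n) ℚ.- r ℚ.* u ℚ.+ q ℚ.* (1ℚ ℚ.- 1ℚ)
      ≡⟨ collapse q r k n u ⟩
    k ℚ.* (n ℚ.* u)
      ≡⟨ cong (k ℚ.*_) (ℚP.*-inverseʳ n) ⟩
    k ℚ.* 1ℚ
      ≡⟨ ℚP.*-identityʳ k ⟩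
    k ∎)
    where
    open ≡-Reasoning
    r k : ℚ
    r = ι (+ F.toℕ (residue m))
    k = ι (m /ℕ N)
    m-split : ι m ≡ r ℚ.+ k ℚ.* n
    m-split = begin
      ι m                                   ≡⟨ cong ι (a≡a%ℕn+[a/ℕn]*n m N) ⟩
      ι (+ (m %ℕ N) + (m /ℕ N) * + N)       ≡⟨ ι-+ (+ (m %ℕ N)) ((m /ℕ N) * + N) ⟩
      ι (+ (m %ℕ N)) ℚ.+ ι ((m /ℕ N) * + N) ≡⟨ cong (ℚ._+_ (ι (+ (m %ℕ N)))) (ι-* (m /ℕ N) (+ N)) ⟩
      ι (+ (m %ℕ N)) ℚ.+ k ℚ.* n            ≡⟨ cong (λ t → ι (+ t) ℚ.+ k ℚ.* n) (toℕ-residue m) ⟨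
      r ℚ.+ k ℚ.* n                         ∎
    expand : ∀ q r n u →
             q ℚ.- r ℚ.* u ≡ u ℚ.* (n ℚ.* q ℚ.- 0ℚ) ℚ.- r ℚ.* u ℚ.+ q ℚ.* (1ℚ ℚ.- n ℚ.* u)
    expand = RS.solve-∀ ℚ-ring
    collapse : ∀ q r k n u →
               u ℚ.* (r ℚ.+ k ℚ.* n) ℚ.- r ℚ.* u ℚ.+ q ℚ.* (1ℚ ℚ.- 1ℚ) ≡ k ℚ.* (n ℚ.* u)
    collapse = RS.solve-∀ ℚ-ring

-- The order on Gr M

compress : ∀ {m} (B : Subset m) → Subset m → Subset SS.∣ B ∣
compress []          []      = []
compress (true ∷ B)  (a ∷ A) = a ∷ compress B A
compress (false ∷ B) (_ ∷ A) = compress B A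

expand : ∀ {m} (B : Subset m) → Subset SS.∣ B ∣ → Subset m
expand []          _       = []
expand (true ∷ B)  (s ∷ S) = s ∷ expand B S
expand (false ∷ B) S       = false ∷ expand B S

compress-expand : ∀ {m} (B : Subset m) S → compress B (expand B S) ≡ S
compress-expand []          []      = refl
compress-expand (true ∷ B)  (s ∷ S) = cong (s ∷_) (compress-expand B S)
compress-expand (false ∷ B) S       = compress-expand B S

private
  drop-⊆ : ∀ {m a b} {A B : Subset m} → (a ∷ A) ⊆ (b ∷ B) → A ⊆ B
  drop-⊆ A⊆B i∈ with A⊆B (there i∈)
  ... | there i∈B = i∈B

expand-compress : ∀ {m} (B A : Subset m) → A ⊆ B → expand B (compress B A) ≡ A
expand-compress []          []          _   = refl
expand-compress (true ∷ B)  (a ∷ A)     A⊆B = cong (a ∷_) (expand-compress B A (drop-⊆ A⊆B))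
expand-compress (false ∷ B) (true ∷ A)  A⊆B with A⊆B here
... | ()
expand-compress (false ∷ B) (false ∷ A) A⊆B = cong (false ∷_) (expand-compress B A (drop-⊆ A⊆B))

expand-⊆ : ∀ {m} (B : Subset m) S → expand B S ⊆ B
expand-⊆ (true ∷ B)  (s ∷ S) here     = here
expand-⊆ (true ∷ B)  (s ∷ S) (there i∈) = there (expand-⊆ B S i∈)
expand-⊆ (false ∷ B) S       (there i∈) = there (expand-⊆ B S i∈)

compress-mono : ∀ {m} (B : Subset m) {A A′} → A ⊆ A′ → compress B A ⊆ compress B A′
compress-mono (true ∷ B)  {true ∷ A} {a′ ∷ A′} A⊆A′ here with A⊆A′ here
... | here = here
compress-mono (true ∷ B)  {_ ∷ A} {_ ∷ A′} A⊆A′ (there i∈) = there (compress-mono B (drop-⊆ A⊆A′) i∈)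
compress-mono (false ∷ B) {_ ∷ A} {_ ∷ A′} A⊆A′ i∈         = compress-mono B (drop-⊆ A⊆A′) i∈

expand-mono : ∀ {m} (B : Subset m) {S S′} → S ⊆ S′ → expand B S ⊆ expand B S′
expand-mono (true ∷ B)  {true ∷ S} {s′ ∷ S′} S⊆S′ here with S⊆S′ here
... | here = here
expand-mono (true ∷ B)  {_ ∷ S} {_ ∷ S′} S⊆S′ (there i∈) = there (expand-mono B (drop-⊆ S⊆S′) i∈)
expand-mono (false ∷ B) S⊆S′ (there i∈) = there (expand-mono B S⊆S′ i∈)

module Order {n d} (z : Fin n → Vec ℤ d) where
  open Realized z

  span-mono : ∀ {A B} → A ⊆ B → ∀ {v} → InSpan A v → InSpan B v
  span-mono A⊆B (c , c-supported , eq) = c , (λ i i∉ → c-supported i (i∉ ∘ A⊆B)) , eq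

  tors-mono : ∀ {A B} → A ⊆ B → ∀ {v} → IsTors A v → IsTors B v
  tors-mono A⊆B (k , k≢0 , kv∈) = k , k≢0 , span-mono A⊆B kv∈

  restrict : (σ : Gr) {A : Subset n} → A ⊆ set σ → Gr
  restrict σ {A} A⊆ = ⟨ A , rank′ , char′ ⟩
    where
    rank′ : RankCond A
    rank′ c c-supported = rank σ c (λ i i∉ → c-supported i (i∉ ∘ A⊆))
    char′ : Char A
    char′ = record
      { χ        = χ (chr σ)
      ; wellDef  = λ v w v-tors w-tors v-w∈ →
                     wellDef (chr σ) v w (tors-mono A⊆ v-tors) (tors-mono A⊆ w-tors) (span-mono A⊆ v-w∈)
      ; additive = λ v w v-tors w-tors → additive (chr σ) v w (tors-mono A⊆ v-tors) (tors-mono A⊆ w-tors)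
      }

  infix 4 _⊑_
  record _⊑_ (x y : Gr) : Set where
    constructor mk⊑
    field
      set-⊆    : set x ⊆ set y
      χ-agrees : ∀ v → IsTors (set x) v → χ (chr x) v ≈ℚ/ℤ χ (chr y) v
  open _⊑_

  ⊑-refl : ∀ {x} → x ⊑ x
  ⊑-refl {x} = mk⊑ (λ i∈ → i∈) λ v _ → ≈ℚ/ℤ-refl {χ (chr x) v}

  ⊑-trans : ∀ {x y w} → x ⊑ y → y ⊑ w → x ⊑ w
  ⊑-trans {x} {y} {w} (mk⊑ x⊆y x~y) (mk⊑ y⊆w y~w) = mk⊑ (y⊆w ∘ x⊆y) λ v v-tors → begin
    χ (chr x) v ≈⟨ x~y v v-tors ⟩
    χ (chr y) v ≈⟨ y~w v (tors-mono x⊆y v-tors) ⟩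
    χ (chr w) v ∎
    where open ℚ/ℤ-Reasoning

  ≈⇒⊑ : ∀ {x y} → x ≈ y → x ⊑ y
  ≈⇒⊑ (refl , x~y) = mk⊑ (λ i∈ → i∈) x~y

  covered⇒⊑ : ∀ {x y} → Covers y x → x ⊑ y
  covered⇒⊑ {x} {y} (b , _ , refl , y~x) =
    mk⊑ (SSP.p⊆p∪q ⁅ b ⁆) λ v v-tors → ≈ℚ/ℤ-sym {χ (chr y) v} {χ (chr x) v} (y~x v v-tors)

  ≤⇒⊑ : ∀ {x y} → x ≤ y → x ⊑ y
  ≤⇒⊑ ε            = ⊑-refl
  ≤⇒⊑ (step ◅ y≤) = ⊑-trans ([ ≈⇒⊑ , covered⇒⊑ ]′ step) (≤⇒⊑ y≤)

  restrict-≈ : ∀ σ {A B} (A⊆ : A ⊆ set σ) (B⊆ : B ⊆ set σ) →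
               A ≡ B → restrict σ A⊆ ≈ restrict σ B⊆
  restrict-≈ σ _ _ refl = refl , λ v _ → ≈ℚ/ℤ-refl {χ (chr σ) v}

  restrict-mono : ∀ σ {A B} (A⊆B : A ⊆ B) (B⊆ : B ⊆ set σ) →
                  restrict σ (B⊆ ∘ A⊆B) ≤ restrict σ B⊆
  restrict-mono σ {A} {B} A⊆B B⊆ = go (⊃-wellFounded A) A⊆B
    where
    go : ∀ {C} → Acc _⊃_ C → (C⊆B : C ⊆ B) → restrict σ (B⊆ ∘ C⊆B) ≤ restrict σ B⊆
    go {C} (acc larger) C⊆B with FP.any? (λ i → (i SSP.∈? B) ×-dec ¬? (i SSP.∈? C))
    ... | no none = inj₁ (restrict-≈ σ (B⊆ ∘ C⊆B) B⊆ (SSP.⊆-antisym C⊆B B⊆C)) ◅ ε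
      where
      B⊆C : B ⊆ C
      B⊆C {i} i∈B with i SSP.∈? C
      ... | yes i∈C = i∈C
      ... | no  i∉C = ⊥-elim (none (i , i∈B , i∉C))
    ... | yes (i , i∈B , i∉C) =
      inj₂ (i , i∉C , refl , λ v _ → ≈ℚ/ℤ-refl {χ (chr σ) v}) ◅ go (larger C⊂C′) C′⊆B
      where
      C′⊆B : C ∪ ⁅ i ⁆ ⊆ B
      C′⊆B {j} j∈ with SSP.x∈p∪q⁻ C ⁅ i ⁆ j∈
      ... | inj₁ j∈C    = C⊆B j∈C
      ... | inj₂ j∈⁅i⁆ = subst (_∈ B) (sym (SSP.x∈⁅y⁆⇒x≡y i j∈⁅i⁆)) i∈B
      C⊂C′ : (C ∪ ⁅ i ⁆) ⊃ C
      C⊂C′ = SSP.p⊆p∪q ⁅ i ⁆ , i , SSP.q⊆p∪q C ⁅ i ⁆ (SSP.x∈⁅x⁆ i) , i∉C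

  ⊑⇒≤ : ∀ {x y} → x ⊑ y → x ≤ y
  ⊑⇒≤ {x} {y} (mk⊑ x⊆y x~y) =
    inj₁ (refl , x~y) ◅ restrict-mono y x⊆y (λ i∈ → i∈) ◅◅
    inj₁ (restrict-≈ y (λ i∈ → i∈) (λ i∈ → i∈) refl) ◅ ε

  antisym : ∀ x y → x ≤ y → y ≤ x → x ≈ y
  antisym x y x≤y y≤x = SSP.⊆-antisym (set-⊆ x⊑y) (set-⊆ (≤⇒⊑ y≤x)) , χ-agrees x⊑y
    where x⊑y = ≤⇒⊑ x≤y

  ≈-sym : ∀ {x y} → x ≈ y → y ≈ x
  ≈-sym {x} {y} (refl , x~y) = refl , λ v v-tors → ≈ℚ/ℤ-sym {χ (chr x) v} {χ (chr y) v} (x~y v v-tors)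

  tors-⊥ : ∀ {v} → IsTors SS.⊥ v → v ≡ 0ᵥ
  tors-⊥ {v} (k , k≢0 , c , c-supported , c-kv) = ·ᵥ-cancelˡ k {{k≢0}} v 0ᵥ (begin
    (+ k) ·ᵥ v  ≡⟨ c-kv ⟨
    lincomb z c ≡⟨ lincomb-zero z (λ i → c-supported i SSP.∉⊥) ⟩
    0ᵥ          ≡⟨ ·ᵥ-zeroʳ (+ k) ⟨
    (+ k) ·ᵥ 0ᵥ ∎)
    where open ≡-Reasoning

  tors-0ᵥ : ∀ A → IsTors A 0ᵥ
  tors-0ᵥ A = 1 , _ , (λ _ → + 0) , (λ _ _ → refl) ,
              trans (lincomb-zero z (λ _ → refl)) (sym (·ᵥ-identityˡ 0ᵥ))

  χ-0ᵥ : ∀ {A} (l : Char A) → χ l 0ᵥ ≈ℚ/ℤ 0ℚ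
  χ-0ᵥ {A} l = idempotent (begin
    q              ≡⟨ cong (χ l) (+ᵥ-identityˡ 0ᵥ) ⟨
    χ l (0ᵥ +ᵥ 0ᵥ) ≈⟨ additive l 0ᵥ 0ᵥ (tors-0ᵥ A) (tors-0ᵥ A) ⟩
    q ℚ.+ q        ∎)
    where
    open ℚ/ℤ-Reasoning
    q = χ l 0ᵥ
    flip : ∀ q → q ℚ.- 0ℚ ≡ ℚ.- (q ℚ.- (q ℚ.+ q))
    flip = RS.solve-∀ ℚ-ring
    idempotent : q ≈ℚ/ℤ (q ℚ.+ q) → q ≈ℚ/ℤ 0ℚ
    idempotent (m , q-2q) = - m , trans (flip q) (trans (cong ℚ.-_ q-2q) (sym (ι-neg m)))

  0̂ : Gr
  0̂ = ⟨ SS.⊥ , (λ c c-supported _ i → c-supported i SSP.∉⊥) , zero-char ⟩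
    where
    zero-char : Char SS.⊥
    zero-char = record
      { χ        = λ _ → 0ℚ
      ; wellDef  = λ _ _ _ _ _ → ≈ℚ/ℤ-refl {0ℚ}
      ; additive = λ _ _ _ _ → ≈ℚ/ℤ-refl {0ℚ}
      }

  0̂⊑ : ∀ x → 0̂ ⊑ x
  0̂⊑ x = mk⊑ SSP.⊥⊆ λ v v-tors → begin
    0ℚ           ≈⟨ χ-0ᵥ (chr x) ⟨
    χ (chr x) 0ᵥ ≡⟨ cong (χ (chr x)) (tors-⊥ v-tors) ⟨
    χ (chr x) v  ∎
    where open ℚ/ℤ-Reasoning

  0̂-minimal : ∀ y → y ≤ 0̂ → y ≈ 0̂
  0̂-minimal y y≤0̂ = SSP.⊆-antisym (set-⊆ (≤⇒⊑ y≤0̂)) SSP.⊥⊆ , χ-agrees (≤⇒⊑ y≤0̂)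

  0̂-unique : ∀ x → (∀ y → y ≤ x → y ≈ x) → x ≈ 0̂
  0̂-unique x minimal = ≈-sym {0̂} {x} (minimal 0̂ (⊑⇒≤ (0̂⊑ x)))

  interval-boolean : ∀ σ → Σ (Interval 0̂ σ → Subset SS.∣ set σ ∣) λ f →
                           Σ (Subset SS.∣ set σ ∣ → Interval 0̂ σ) λ g →
                           (∀ S → f (g S) ≡ S) × (∀ x → proj₁ (g (f x)) ≈ proj₁ x) ×
                           (∀ x y → (proj₁ x ≤ proj₁ y) ⇔ (f x ⊆ f y))
  interval-boolean σ = f , g , compress-expand B , g∘f , order-iso
    where
    B = set σ
    f : Interval 0̂ σ → Subset SS.∣ B ∣
    f (x , _) = compress B (set x)
    g : Subset SS.∣ B ∣ → Interval 0̂ σ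
    g S = restrict σ (expand-⊆ B S) , ⊑⇒≤ (0̂⊑ _) ,
          ⊑⇒≤ (mk⊑ (expand-⊆ B S) λ v _ → ≈ℚ/ℤ-refl {χ (chr σ) v})
    g∘f : ∀ x → proj₁ (g (f x)) ≈ proj₁ x
    g∘f (x , _ , x≤σ) = expand-compress B (set x) x⊆B , λ v v-tors →
      ≈ℚ/ℤ-sym {χ (chr x) v} {χ (chr σ) v}
        (χ-agrees x⊑σ v (subst (λ A → IsTors A v) (expand-compress B (set x) x⊆B) v-tors))
      where
      x⊑σ = ≤⇒⊑ x≤σ
      x⊆B = set-⊆ x⊑σ
    order-iso : ∀ x y → (proj₁ x ≤ proj₁ y) ⇔ (f x ⊆ f y)
    order-iso (x , _ , x≤σ) (y , _ , y≤σ) = mk⇔ to from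
      where
      x⊑σ = ≤⇒⊑ x≤σ
      y⊑σ = ≤⇒⊑ y≤σ
      to : x ≤ y → compress B (set x) ⊆ compress B (set y)
      to x≤y = compress-mono B (set-⊆ (≤⇒⊑ x≤y))
      from : compress B (set x) ⊆ compress B (set y) → x ≤ y
      from fx⊆fy = ⊑⇒≤ (mk⊑ x⊆y x~y)
        where
        x⊆y : set x ⊆ set y
        x⊆y {i} i∈ = subst (i ∈_) (expand-compress B (set y) (set-⊆ y⊑σ))
          (expand-mono B fx⊆fy (subst (i ∈_) (sym (expand-compress B (set x) (set-⊆ x⊑σ))) i∈))
        x~y : ∀ v → IsTors (set x) v → χ (chr x) v ≈ℚ/ℤ χ (chr y) v
        x~y v v-tors = begin
          χ (chr x) v ≈⟨ χ-agrees x⊑σ v v-tors ⟩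
          χ (chr σ) v ≈⟨ χ-agrees y⊑σ v (tors-mono x⊆y v-tors) ⟨
          χ (chr y) v ∎
          where open ℚ/ℤ-Reasoning

-- Finiteness

allVectors : ∀ {A : Set} → List A → (m : ℕ) → List (Vec A m)
allVectors xs zero    = [] L.∷ L.[]
allVectors xs (suc m) = L.cartesianProductWith _∷_ xs (allVectors xs m)

∈-allVectors : ∀ {A : Set} {xs : List A} → (∀ x → x ∈ₗ xs) →
               ∀ {m} (v : Vec A m) → v ∈ₗ allVectors xs m
∈-allVectors complete []      = Any.here refl
∈-allVectors complete (x ∷ v) = ∈ₗ.∈-cartesianProductWith⁺ _∷_ (complete x) (∈-allVectors complete v)

∈-concatMap⁺′ : ∀ {A B : Set} (f : A → List B) {x y xs} →
                x ∈ₗ xs → y ∈ₗ f x → y ∈ₗ L.concatMap f xs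
∈-concatMap⁺′ f x∈ y∈ = ∈ₗ.∈-concat⁺′ y∈ (∈ₗ.∈-map⁺ f x∈)

module Characters {n d} (z : Fin n → Vec ℤ d) {A : Subset n} (B : DualBasis z A) where
  open Realized z
  open DualBasis B
  open Torsion z B
  open Remainders N
  open Fractions N
  open Order z using (tors-0ᵥ; χ-0ᵥ)

  Code : Set
  Code = Vec (Fin N) n

  code : Vec ℤ d → Code
  code v = V.tabulate (λ i → residue (coords v i))

  lookup-code : ∀ v i → lookup (code v) i ≡ residue (coords v i)
  lookup-code v i = VP.lookup∘tabulate _ i

  code-span : ∀ {v w} → InSpan A (v -ᵥ w) → code v ≡ code w
  code-span {v} {w} v-w∈@(c , _) = lookup-ext λ i → begin
    lookup (code v) i                ≡⟨ lookup-code v i ⟩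
    residue (coords v i)             ≡⟨ cong residue (shift i) ⟩
    residue (coords w i + c i * + N) ≡⟨ residue-+multiple (coords w i) (c i) ⟩
    residue (coords w i)             ≡⟨ lookup-code w i ⟨
    lookup (code w) i                ∎
    where
    open ≡-Reasoning
    split : ∀ a b → a ≡ b + (a - b)
    split = solve-∀
    shift : ∀ i → coords v i ≡ coords w i + c i * + N
    shift i = begin
      coords v i                             ≡⟨ split (coords v i) (coords w i) ⟩
      coords w i + (coords v i - coords w i) ≡⟨ cong (_+_ (coords w i)) (ap--ᵥ (φ i) v w) ⟨
      coords w i + coords (v -ᵥ w) i         ≡⟨ cong (_+_ (coords w i)) (inSpan⇒coords v-w∈ i) ⟩
      coords w i + c i * + N                 ∎

  code-congruent : ∀ {u u′} → code u ≡ code u′ → ∀ i → ∃[ q ] coords u i ≡ coords u′ i + q * + N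
  code-congruent {u} {u′} u≡u′ i = residue-injective (coords u i) (coords u′ i) (begin
    residue (coords u i)  ≡⟨ lookup-code u i ⟨
    lookup (code u) i     ≡⟨ cong (λ r → lookup r i) u≡u′ ⟩
    lookup (code u′) i    ≡⟨ lookup-code u′ i ⟩
    residue (coords u′ i) ∎)
    where open ≡-Reasoning

  span-code : ∀ {v w} → IsTors A v → IsTors A w → code v ≡ code w → InSpan A (v -ᵥ w)
  span-code {v} {w} v-tors w-tors v≡w = coords⇒inSpan (tors-- v-tors w-tors) q coords-v-w
    where
    q : Fin n → ℤ
    q i = proj₁ (code-congruent v≡w i)
    cancel : ∀ b x → b + x - b ≡ x
    cancel = solve-∀
    coords-v-w : ∀ i → coords (v -ᵥ w) i ≡ q i * + N
    coords-v-w i = begin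
      coords (v -ᵥ w) i                   ≡⟨ ap--ᵥ (φ i) v w ⟩
      coords v i - coords w i             ≡⟨ cong (_- coords w i) (proj₂ (code-congruent v≡w i)) ⟩
      coords w i + q i * + N - coords w i ≡⟨ cancel (coords w i) (q i * + N) ⟩
      q i * + N                           ∎
      where open ≡-Reasoning

  code-+ : ∀ {v v′ w w′} → code v ≡ code v′ → code w ≡ code w′ →
           code (v +ᵥ w) ≡ code (v′ +ᵥ w′)
  code-+ {v} {v′} {w} {w′} v≡v′ w≡w′ = lookup-ext λ i → begin
    lookup (code (v +ᵥ w)) i                          ≡⟨ lookup-code (v +ᵥ w) i ⟩
    residue (coords (v +ᵥ w) i)                       ≡⟨ cong residue (shift i) ⟩
    residue (coords (v′ +ᵥ w′) i + (q i + r i) * + N)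
                                                      ≡⟨ residue-+multiple (coords (v′ +ᵥ w′) i) (q i + r i) ⟩
    residue (coords (v′ +ᵥ w′) i)                     ≡⟨ lookup-code (v′ +ᵥ w′) i ⟨
    lookup (code (v′ +ᵥ w′)) i                        ∎
    where
    open ≡-Reasoning
    q r : Fin n → ℤ
    q i = proj₁ (code-congruent v≡v′ i)
    r i = proj₁ (code-congruent w≡w′ i)
    regroup : ∀ a b x y n → (a + x * n) + (b + y * n) ≡ (a + b) + (x + y) * n
    regroup = solve-∀
    shift : ∀ i → coords (v +ᵥ w) i ≡ coords (v′ +ᵥ w′) i + (q i + r i) * + N
    shift i = begin
      coords (v +ᵥ w) i                                     ≡⟨ ap-+ (φ i) v w ⟩
      coords v i + coords w i                               ≡⟨ cong₂ _+_ (proj₂ (code-congruent v≡v′ i))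
                                                                             (proj₂ (code-congruent w≡w′ i)) ⟩
      (coords v′ i + q i * + N) + (coords w′ i + r i * + N) ≡⟨ regroup (coords v′ i) (coords w′ i)
                                                                        (q i) (r i) (+ N) ⟩
      (coords v′ i + coords w′ i) + (q i + r i) * + N       ≡⟨ cong (_+ (q i + r i) * + N) (ap-+ (φ i) v′ w′) ⟨
      coords (v′ +ᵥ w′) i + (q i + r i) * + N               ∎

  toℤ : Code → Fin n → ℤ
  toℤ r i = + F.toℕ (lookup r i)

  ValidCode : Code → Set
  ValidCode r = SupportedOn A (toℤ r) × (∀ p → lookup (lincomb z (toℤ r)) p %ℕ N ≡ 0)

  validCode? : ∀ r → Dec (ValidCode r)
  validCode? r = FP.all? (λ i → ¬? (i SSP.∈? A) →-dec (toℤ r i ℤ.≟ + 0))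
           ×-dec FP.all? (λ p → lookup (lincomb z (toℤ r)) p %ℕ N ℕ.≟ 0)

  representative : Code → Vec ℤ d
  representative r = V.map (_/ℕ N) (lincomb z (toℤ r))

  N·representative : ∀ r → ValidCode r → (+ N) ·ᵥ representative r ≡ lincomb z (toℤ r)
  N·representative r (_ , divisible) = lookup-ext λ p → begin
    lookup ((+ N) ·ᵥ representative r) p ≡⟨ lookup-·ᵥ (+ N) (representative r) p ⟩
    + N * lookup (representative r) p    ≡⟨ cong (_*_ (+ N)) (VP.lookup-map p (_/ℕ N) (lincomb z (toℤ r))) ⟩
    + N * (x p /ℕ N)                     ≡⟨ ℤP.*-comm (+ N) (x p /ℕ N) ⟩
    (x p /ℕ N) * + N                     ≡⟨ %ℕ≡0⇒ (x p) (divisible p) ⟨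
    x p                                  ∎
    where
    open ≡-Reasoning
    x : Fin d → ℤ
    x p = lookup (lincomb z (toℤ r)) p

  representative-tors : ∀ r → ValidCode r → IsTors A (representative r)
  representative-tors r valid = N , N≢0 , toℤ r , proj₁ valid , sym (N·representative r valid)

  code-representative : ∀ r → ValidCode r → code (representative r) ≡ r
  code-representative r valid = lookup-ext λ i → begin
    lookup (code (representative r)) i    ≡⟨ lookup-code (representative r) i ⟩
    residue (coords (representative r) i) ≡⟨ cong residue (ℤP.*-cancelˡ-≡ (+ N) _ _ (N·coords i)) ⟩
    residue (toℤ r i)                     ≡⟨ residue-toℕ (lookup r i) ⟩
    lookup r i                            ∎
    where
    open ≡-Reasoning
    N·coords : ∀ i → + N * coords (representative r) i ≡ + N * toℤ r i
    N·coords i = begin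
      + N * coords (representative r) i    ≡⟨ ap-· (φ i) (+ N) (representative r) ⟨
      coords ((+ N) ·ᵥ representative r) i ≡⟨ cong (λ u → coords u i) (N·representative r valid) ⟩
      coords (lincomb z (toℤ r)) i         ≡⟨ φ-lincomb (toℤ r) (proj₁ valid) i ⟩
      toℤ r i * + N                        ≡⟨ ℤP.*-comm (toℤ r i) (+ N) ⟩
      + N * toℤ r i                        ∎

  toℤ-code : ∀ v i → toℤ (code v) i ≡ + (coords v i %ℕ N)
  toℤ-code v i = trans (cong (λ r → + F.toℕ r) (lookup-code v i)) (cong +_ (toℕ-residue (coords v i)))

  code-supported : ∀ v → SupportedOn A (toℤ (code v))
  code-supported v i i∉ = begin
    toℤ (code v) i      ≡⟨ toℤ-code v i ⟩
    + (coords v i %ℕ N) ≡⟨ cong (λ a → + (a %ℕ N)) (coords-supported v i i∉) ⟩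
    + (0 ℕ.% N)         ≡⟨ cong +_ (ℕD.m*n%n≡0 0 N) ⟩
    + 0                 ∎
    where open ≡-Reasoning

  quotients : Vec ℤ d → Fin n → ℤ
  quotients v i = coords v i /ℕ N

  code-decomposition : ∀ {v} → IsTors A v →
                       lincomb z (toℤ (code v)) +ᵥ ((+ N) ·ᵥ lincomb z (quotients v)) ≡ (+ N) ·ᵥ v
  code-decomposition {v} v-tors = begin
    lincomb z (toℤ (code v)) +ᵥ ((+ N) ·ᵥ lincomb z Q)      ≡⟨ cong (_+ᵥ_ _) (lincomb-· z (+ N) Q) ⟨
    lincomb z (toℤ (code v)) +ᵥ lincomb z (λ i → + N * Q i) ≡⟨ lincomb-+ z (toℤ (code v))
                                                                          (λ i → + N * Q i) ⟨
    lincomb z (λ i → toℤ (code v) i + + N * Q i)            ≡⟨ lincomb-cong z split ⟩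
    lincomb z (coords v)                                    ≡⟨ torsion-decomposition v-tors ⟨
    (+ N) ·ᵥ v                                              ∎
    where
    open ≡-Reasoning
    Q = quotients v
    split : ∀ i → toℤ (code v) i + + N * Q i ≡ coords v i
    split i = begin
      toℤ (code v) i + + N * Q i      ≡⟨ cong₂ _+_ (toℤ-code v i) (ℤP.*-comm (+ N) (Q i)) ⟩
      + (coords v i %ℕ N) + Q i * + N ≡⟨ a≡a%ℕn+[a/ℕn]*n (coords v i) N ⟨
      coords v i                      ∎

  code-valid : ∀ {v} → IsTors A v → ValidCode (code v)
  code-valid {v} v-tors = code-supported v , λ p →
    multiple⇒%ℕ≡0 _ (lookup v p - lookup (lincomb z (quotients v)) p)
                  (lookup-isolate (+ N) _ v _ (code-decomposition v-tors) p)

  χ-multiple : ∀ (l : Char A) {v} → IsTors A v → ∀ k → χ l ((+ k) ·ᵥ v) ≈ℚ/ℤ (ι (+ k) ℚ.* χ l v)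
  χ-multiple l {v} v-tors zero = begin
    χ l ((+ 0) ·ᵥ v)  ≡⟨ cong (χ l) (·ᵥ-zeroˡ v) ⟩
    χ l 0ᵥ            ≈⟨ χ-0ᵥ l ⟩
    0ℚ                ≡⟨ ℚP.*-zeroˡ (χ l v) ⟨
    ι (+ 0) ℚ.* χ l v ∎
    where open ℚ/ℤ-Reasoning
  χ-multiple l {v} v-tors (suc k) = begin
    χ l ((+ suc k) ·ᵥ v)        ≡⟨ cong (χ l) (·ᵥ-suc k v) ⟩
    χ l (v +ᵥ ((+ k) ·ᵥ v))     ≈⟨ additive l v ((+ k) ·ᵥ v) v-tors (tors-· (+ k) v-tors) ⟩
    χ l v ℚ.+ χ l ((+ k) ·ᵥ v)  ≈⟨ ≈ℚ/ℤ-+ {χ l v} {χ l v} (≈ℚ/ℤ-refl {χ l v})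
                                            (χ-multiple l v-tors k) ⟩
    χ l v ℚ.+ ι (+ k) ℚ.* χ l v ≡⟨ collect (χ l v) (ι (+ k)) ⟩
    (1ℚ ℚ.+ ι (+ k)) ℚ.* χ l v  ≡⟨ cong (ℚ._* χ l v) (ι-+ (+ 1) (+ k)) ⟨
    ι (+ suc k) ℚ.* χ l v       ∎
    where
    open ℚ/ℤ-Reasoning
    collect : ∀ q a → q ℚ.+ a ℚ.* q ≡ (1ℚ ℚ.+ a) ℚ.* q
    collect = RS.solve-∀ ℚ-ring

  χ-N-torsion : ∀ (l : Char A) {v} → IsTors A v → (ι (+ N) ℚ.* χ l v) ≈ℚ/ℤ 0ℚ
  χ-N-torsion l {v} v-tors = begin
    ι (+ N) ℚ.* χ l v ≈⟨ χ-multiple l v-tors N ⟨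
    χ l ((+ N) ·ᵥ v)  ≈⟨ wellDef l ((+ N) ·ᵥ v) 0ᵥ (tors-· (+ N) v-tors) (tors-0ᵥ A) Nv∈ ⟩
    χ l 0ᵥ            ≈⟨ χ-0ᵥ l ⟩
    0ℚ                ∎
    where
    open ℚ/ℤ-Reasoning
    Nv∈ : InSpan A (((+ N) ·ᵥ v) -ᵥ 0ᵥ)
    Nv∈ = coords v , coords-supported v ,
          trans (sym (torsion-decomposition v-tors)) (sym (-ᵥ-identityʳ ((+ N) ·ᵥ v)))

  allCodes : List Code
  allCodes = allVectors (L.allFin N) n

  code-index : Code → Fin (L.length allCodes)
  code-index r = Any.index (∈-allVectors ∈ₗ.∈-allFin r)

  Table : Set
  Table = Vec (Fin N) (L.length allCodes)

  value : Table → Code → ℚ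
  value T r = frac (lookup T (code-index r))

  tableχ : Table → Vec ℤ d → ℚ
  tableχ T v = value T (code v)

  AdditiveAt : Table → Code → Code → Set
  AdditiveAt T r s = tableχ T (representative r +ᵥ representative s)
                       ≈ℚ/ℤ (tableχ T (representative r) ℚ.+ tableχ T (representative s))

  ValidTable : Table → Set
  ValidTable T = ∀ r s → ValidCode r → ValidCode s → AdditiveAt T r s

  validTable? : ∀ T → Dec (ValidTable T)
  validTable? T = map′ (λ all r s → All.lookup (All.lookup all (∈-allCodes r)) (∈-allCodes s))
                       (λ valid → All.tabulate (λ {r} _ → All.tabulate (λ {s} _ → valid r s)))
                       (All.all? (λ r → All.all? (valid-at? r) allCodes) allCodes)
    where
    additiveAt? : ∀ r s → Dec (AdditiveAt T r s)
    additiveAt? r s = tableχ T (representative r +ᵥ representative s)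
                        ≈ℚ/ℤ? (tableχ T (representative r) ℚ.+ tableχ T (representative s))
    valid-at? : ∀ r s → Dec (ValidCode r → ValidCode s → AdditiveAt T r s)
    valid-at? r s = validCode? r →-dec (validCode? s →-dec additiveAt? r s)
    ∈-allCodes : ∀ r → r ∈ₗ allCodes
    ∈-allCodes = ∈-allVectors ∈ₗ.∈-allFin

  tableChar : ∀ T → ValidTable T → Char A
  tableChar T valid = record
    { χ        = tableχ T
    ; wellDef  = λ v w _ _ v-w∈ → ≈ℚ/ℤ-reflexive (cong (value T) (code-span v-w∈))
    ; additive = additive′
    }
    where
    additive′ : ∀ v w → IsTors A v → IsTors A w → tableχ T (v +ᵥ w) ≈ℚ/ℤ (tableχ T v ℚ.+ tableχ T w)
    additive′ v w v-tors w-tors = begin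
      tableχ T (v +ᵥ w)          ≡⟨ cong (value T) (code-+ (sym v̂-code) (sym ŵ-code)) ⟩
      tableχ T (v̂ +ᵥ ŵ)         ≈⟨ valid (code v) (code w) cv cw ⟩
      tableχ T v̂ ℚ.+ tableχ T ŵ ≡⟨ cong₂ ℚ._+_ (cong (value T) v̂-code) (cong (value T) ŵ-code) ⟩
      tableχ T v ℚ.+ tableχ T w  ∎
      where
      open ℚ/ℤ-Reasoning
      cv = code-valid v-tors
      cw = code-valid w-tors
      v̂ = representative (code v)
      ŵ = representative (code w)
      v̂-code = code-representative (code v) cv
      ŵ-code = code-representative (code w) cw

  module TableOf (l : Char A) where

    fraction : ∀ r → ValidCode r → ∃[ t ] χ l (representative r) ≈ℚ/ℤ frac t
    fraction r valid = N-torsion⇒frac (χ l (representative r)) (χ-N-torsion l (representative-tors r valid))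

    -- the entry at a code of no torsion vector is never consulted
    entry-from : ∀ r → Dec (ValidCode r) → Fin N
    entry-from r (yes valid) = proj₁ (fraction r valid)
    entry-from r (no  _)     = residue (+ 0)

    entry : Code → Fin N
    entry r = entry-from r (validCode? r)

    entry-spec : ∀ r → ValidCode r → χ l (representative r) ≈ℚ/ℤ frac (entry r)
    entry-spec r valid = spec (validCode? r)
      where
      spec : (valid? : Dec (ValidCode r)) → χ l (representative r) ≈ℚ/ℤ frac (entry-from r valid?)
      spec (yes valid′)  = proj₂ (fraction r valid′)
      spec (no  invalid) = ⊥-elim (invalid valid)

    table : Table
    table = V.tabulate (λ k → entry (L.lookup allCodes k))

    lookup-table : ∀ r → lookup table (code-index r) ≡ entry r
    lookup-table r = trans (VP.lookup∘tabulate _ (code-index r))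
                           (cong entry (sym (Any.lookup-index (∈-allVectors ∈ₗ.∈-allFin r))))

    table-agrees : ∀ v → IsTors A v → χ l v ≈ℚ/ℤ tableχ table v
    table-agrees v v-tors = begin
      χ l v                 ≈⟨ wellDef l v r̂ v-tors (representative-tors (code v) cv) v-r̂∈ ⟩
      χ l r̂                ≈⟨ entry-spec (code v) cv ⟩
      frac (entry (code v)) ≡⟨ cong frac (lookup-table (code v)) ⟨
      tableχ table v        ∎
      where
      open ℚ/ℤ-Reasoning
      cv = code-valid v-tors
      r̂ = representative (code v)
      v-r̂∈ : InSpan A (v -ᵥ r̂)
      v-r̂∈ = span-code v-tors (representative-tors (code v) cv) (sym (code-representative (code v) cv))

    table-valid : ValidTable table
    table-valid r s valid-r valid-s = begin
      tableχ table (r̂ +ᵥ ŝ)               ≈⟨ table-agrees (r̂ +ᵥ ŝ) (tors-+ r̂-tors ŝ-tors) ⟨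
      χ l (r̂ +ᵥ ŝ)                        ≈⟨ additive l r̂ ŝ r̂-tors ŝ-tors ⟩
      χ l r̂ ℚ.+ χ l ŝ                     ≈⟨ ≈ℚ/ℤ-+ {χ l r̂} {tableχ table r̂} {χ l ŝ} {tableχ table ŝ}
                                               (table-agrees r̂ r̂-tors) (table-agrees ŝ ŝ-tors) ⟩
      tableχ table r̂ ℚ.+ tableχ table ŝ   ∎
      where
      open ℚ/ℤ-Reasoning
      r̂ = representative r
      ŝ = representative s
      r̂-tors = representative-tors r valid-r
      ŝ-tors = representative-tors s valid-s

  candidates-from : ∀ T → Dec (ValidTable T) → List Gr
  candidates-from T (yes valid) = ⟨ A , rankCond , tableChar T valid ⟩ L.∷ L.[]
  candidates-from T (no  _)     = L.[]

  candidates : Table → List Gr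
  candidates T = candidates-from T (validTable? T)

  candidates-complete : ∀ T → ValidTable T →
                        ∃[ y ] (y ∈ₗ candidates T × set y ≡ A × χ (chr y) ≡ tableχ T)
  candidates-complete T valid = from (validTable? T)
    where
    from : (valid? : Dec (ValidTable T)) →
           ∃[ y ] (y ∈ₗ candidates-from T valid? × set y ≡ A × χ (chr y) ≡ tableχ T)
    from (yes _)       = _ , Any.here refl , refl , refl
    from (no  invalid) = ⊥-elim (invalid valid)

  characters : List Gr
  characters = L.concatMap candidates (allVectors (L.allFin N) (L.length allCodes))

  characters-complete : ∀ x → set x ≡ A → ∃[ y ] (y ∈ₗ characters × x ≈ y)
  characters-complete ⟨ _ , _ , l ⟩ refl =
    let y , y∈ , set-y , χ-y = candidates-complete table table-valid
    in  y , ∈-concatMap⁺′ candidates (∈-allVectors ∈ₗ.∈-allFin table) y∈ , sym set-y ,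
        λ v v-tors → subst (λ f → χ l v ≈ℚ/ℤ f v) (sym χ-y) (table-agrees v v-tors)
    where open TableOf l

module Finiteness {n d} (z : Fin n → Vec ℤ d) where
  open Realized z

  charactersFrom : ∀ A → DualBasis z A ⊎ ¬ RankCond A → List Gr
  charactersFrom A (inj₁ B) = Characters.characters z B
  charactersFrom A (inj₂ _) = L.[]

  charactersOver : Subset n → List Gr
  charactersOver A = charactersFrom A (dualBasis-or-dependent z A)

  charactersOver-complete : ∀ x → ∃[ y ] (y ∈ₗ charactersOver (set x) × x ≈ y)
  charactersOver-complete x = from (dualBasis-or-dependent z (set x))
    where
    from : (basis? : DualBasis z (set x) ⊎ ¬ RankCond (set x)) →
           ∃[ y ] (y ∈ₗ charactersFrom (set x) basis? × x ≈ y)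
    from (inj₁ B)         = Characters.characters-complete z B x refl
    from (inj₂ dependent) = ⊥-elim (dependent (rank x))

  finite : ∃[ xs ] (∀ x → ∃[ y ] (y ∈ₗ xs × x ≈ y))
  finite = L.concatMap charactersOver (allVectors (true L.∷ false L.∷ L.[]) n) , λ x →
    let y , y∈ , x≈y = charactersOver-complete x
    in  y , ∈-concatMap⁺′ charactersOver (∈-allVectors bools (set x)) y∈ , x≈y
    where
    bools : ∀ b → b ∈ₗ true L.∷ false L.∷ L.[]
    bools true  = Any.here refl
    bools false = Any.there (Any.here refl)

theorem3p3 : (n d : ℕ) (z : Fin n → Vec ℤ d) →
    IsSimplicialPoset (Realized.Gr z) (Realized._≈_ z) (Realized._≤_ z)
theorem3p3 n d z = record
  { finite   = finite
  ; antisym  = antisym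
  ; 0̂        = 0̂
  ; 0̂-min    = 0̂-minimal
  ; 0̂-unique = 0̂-unique
  ; boolean  = λ σ → _ , interval-boolean σ
  }
  where
  open Order z
  open Finiteness z
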